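{- Let $H$ be a positive integer, $s\ge H+1$, $G$ a triangle-free $T$-regular graph, $1\le k<H$, and let $e$ be an edge of $G$. The stationary distribution $\pi$ of the restriction chain $R_{o,e}$ (defined in the context) is \[ \pi(x)=\begin{cases}\dfrac{1}{\binom{s}{k+1}}\cdot\dfrac12\cdot\dfrac{w_J}{(2^k-1)Tw_I+w_J} & \text{if } x \text{ is } 0\text{ -offset},\\[2ex] \dfrac{1}{\binom{s}{k+1}}\cdot\dfrac12\cdot\dfrac{Tw_I}{(2^k-1)Tw_I+w_J} & \text{otherwise.}\end{cases} \]
   Context: $\mathcal{Q}$ is the simplicial complex with vertex set $V(G)\times[s]$ whose faces are all subsets of sets $\{(v_1,b_1),\dots,(v_{H+1},b_{H+1})\}$ with $b_1,\dots,b_{H+1}\in[s]$ distinct and $v_1,\dots,v_{H+1}\in\{a,c\}$ for some edge $\{a,c\}\in E(G)$. A $k$-face has $k+1$ elements; each $k$-face is uniquely written $(F,f)=\{(f(b),b):b\in F\}$ with $F\subseteq[s]$, $|F|=k+1$, $f:F\to V(G)$ whose image is a single vertex or the two endpoints of an edge. $(F,f)$ is $0$-offset if $f$ is constant. Weights: $w(J)=1$ for $H$-faces; for a $k$-face $F$ with $k<H$, $w(F)=\sum_J w(J)$ over $(k+1)$-faces $J\supseteq F$. For fixed $k$, $w$ equals a common value $w_J$ on $0$-offset $k$-faces and a common value $w_I$ on the others (explicitly $w_I=(H-k)!\binom{s-k-1}{H-k}2^{H-k}$, $w_J=(H-k)!\binom{s-k-1}{H-k}(T2^{H-k}-T+1)$).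 The down-up walk $\mathcal{Q}^{\downarrow\uparrow}_k$: from $F$, remove a uniformly random $x\in F$, then move to a $k$-face $J\supseteq F\setminus\{x\}$ with probability $w(J)/w(F\setminus\{x\})$. The split chain has states $(F,f,c)$: for each $0$-offset $(F,f)$ with image $\{u\}$, the $T$ states $(F,f,\{u,v\})$, $v$ a neighbor of $u$; for every other $(F,f)$, the state $(F,f,\mathrm{image}(f))$; its transition probability $P$ from $(F,f,c)$ to $(F',f',c')$ is $\mathcal{Q}^{\downarrow\uparrow}_k[(F,f)\to(F',f')]/T$ if $(F',f')$ is $0$-offset and $\mathcal{Q}^{\downarrow\uparrow}_k[(F,f)\to(F',f')]$ otherwise. A state $(F,f,c)$ is $0$-offset if $(F,f)$ is. $\Omega_e=\{(F,f,c):c=e\}$, and $R_{o,e}$ is the chain on $\Omega_e$ with $R_{o,e}(x,y)=P(x,y)$ for $x\neq y$ and $R_{o,e}(x,x)=1-\sum_{z\in\Omega_e\setminus\{x\}}P(x,z)$. -}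

module Defs where

open import Data.Bool using (Bool; true; false; _∧_; _∨_; not; if_then_else_)
open import Data.Nat using (ℕ; zero; suc; _∸_; _≡ᵇ_; _!)
open import Data.Nat.Combinatorics using (_C_)
open import Data.Fin using (Fin)
import Data.Fin as Fin
open import Data.Maybe using (Maybe; just; nothing; is-just)
open import Data.List using (List; []; _∷_; [_]; map; filter; concatMap; foldr; length)
open import Data.Bool.ListAction using (all; any)
open import Data.Vec using (Vec; toList; lookup; _[_]≔_; allFin)
import Data.Vec as Vec
open import Data.Integer using (+_)
open import Data.Rational using (ℚ; 0ℚ; 1ℚ; _+_; _*_; _-_; _÷_; ≢-nonZero)
import Data.Rational as ℚ
import Data.Rational.Properties as ℚP
open import Data.Product using (_×_)
open import Data.Empty using (⊥)
open import Relation.Nullary using (yes; no; ⌊_⌋)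
open import Relation.Binary.PropositionalEquality using (_≡_)
import Data.List as List
open import Data.List.Membership.Propositional using (_∈_)

ℕ→ℚ : ℕ → ℚ
ℕ→ℚ n = (+ n) ℚ./ 1

-- total division; only ever applied to nonzero denominators here
_÷'_ : ℚ → ℚ → ℚ
p ÷' q with q ℚP.≟ 0ℚ
... | yes _ = 0ℚ
... | no q≢0 = _÷_ p q {{≢-nonZero q≢0}}

sumℚ : List ℚ → ℚ
sumℚ = foldr _+_ 0ℚ

record Graph : Set where
  field
    n     : ℕ
    adj   : Fin n → Fin n → Bool
    sym   : ∀ a b → adj a b ≡ adj b a
    irrefl : ∀ a → adj a a ≡ false

open Graph public

degree : (G : Graph) → Fin (n G) → ℕ
degree G v = length (filter (λ w → adj G v w Data.Bool.≟ true) (toList (allFin (n G))))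

Regular : Graph → ℕ → Set
Regular G T = ∀ v → degree G v ≡ T

TriangleFree : Graph → Set
TriangleFree G = ∀ a b c → adj G a b ≡ true → adj G b c ≡ true → adj G a c ≡ true → ⊥

-- Faces of Q.  A face (F,f), F ⊆ [s], is encoded as g : Vec (Maybe V) s
-- with g[b] = just (f b) for b ∈ F and g[b] = nothing for b ∉ F.

module Complex (G : Graph) (s : ℕ) where

  V : Set
  V = Fin (n G)

  Cfg : Set
  Cfg = Vec (Maybe V) s

  eqV : V → V → Bool
  eqV a b = ⌊ a Fin.≟ b ⌋

  eqM : Maybe V → Maybe V → Bool
  eqM nothing nothing = true
  eqM (just a) (just b) = eqV a b
  eqM _ _ = false

  allVecs : {A : Set} → List A → (m : ℕ) → List (Vec A m)
  allVecs xs zero = [ Vec.[] ]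
  allVecs xs (suc m) = concatMap (λ x → map (x Vec.∷_) (allVecs xs m)) xs

  allV : List V
  allV = toList (allFin (n G))

  allCfg : List Cfg
  allCfg = allVecs (nothing ∷ map just allV) s

  values : {m : ℕ} → Vec (Maybe V) m → List V
  values Vec.[] = []
  values (nothing Vec.∷ g) = values g
  values (just a Vec.∷ g) = a ∷ values g

  allEqual : List V → Bool
  allEqual [] = true
  allEqual (a ∷ vs) = all (eqV a) vs

  imageOK : Cfg → Bool
  imageOK g = allEqual (values g)
    ∨ any (λ a → any (λ c → adj G a c ∧ all (λ v → eqV v a ∨ eqV v c) (values g)) allV) allV

  isFace : ℕ → Cfg → Bool
  isFace k g = (length (values g) ≡ᵇ suc k) ∧ imageOK g

  faces : ℕ → List Cfg
  faces k = filter (λ g → isFace k g Data.Bool.≟ true) allCfg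

  zeroOffset : Cfg → Bool
  zeroOffset g = allEqual (values g)

  subFace : {m : ℕ} → Vec (Maybe V) m → Vec (Maybe V) m → Bool
  subFace Vec.[] Vec.[] = true
  subFace (nothing Vec.∷ g) (_ Vec.∷ h) = subFace g h
  subFace (just a Vec.∷ g) (x Vec.∷ h) = eqM (just a) x ∧ subFace g h

  -- wAux d k F : weight of a k-face in the complex of top dimension k + d
  wAux : ℕ → ℕ → Cfg → ℚ
  wAux zero k g = 1ℚ
  wAux (suc d) k g =
    sumℚ (map (λ J → if subFace g J then wAux d (suc k) J else 0ℚ) (faces (suc k)))

  w : (H k : ℕ) → Cfg → ℚ
  w H k g = wAux (H ∸ k) k g

  support : Cfg → List (Fin s)
  support g = filter (λ b → is-just (lookup g b) Data.Bool.≟ true) (toList (allFin s))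

  remove : Cfg → Fin s → Cfg
  remove g b = g [ b ]≔ nothing

  downUp : (H k : ℕ) → Cfg → Cfg → ℚ
  downUp H k g J = sumℚ (map (λ b →
       (1ℚ ÷' ℕ→ℚ (suc k)) *
       (if subFace (remove g b) J
          then w H k J ÷' w H (k ∸ 1) (remove g b)
          else 0ℚ))
     (support g))

  wI : (H T k : ℕ) → ℚ
  wI H T k = ℕ→ℚ ((H ∸ k) ! Data.Nat.* ((s ∸ k ∸ 1) C (H ∸ k)) Data.Nat.* (2 Data.Nat.^ (H ∸ k)))

  wJ : (H T k : ℕ) → ℚ
  wJ H T k = ℕ→ℚ ((H ∸ k) ! Data.Nat.* ((s ∸ k ∸ 1) C (H ∸ k))
                  Data.Nat.* (T Data.Nat.* 2 Data.Nat.^ (H ∸ k) ∸ T Data.Nat.+ 1))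

  -- Ω_e for e = {u,c}: the split states (F,f,e); they correspond exactly to the
  -- k-faces (F,f) whose image is contained in {u,c}
  Ωe : (k : ℕ) → V → V → List Cfg
  Ωe k u c = filter (λ g → all (λ v → eqV v u ∨ eqV v c) (values g) Data.Bool.≟ true) (faces k)

  P : (H T k : ℕ) → Cfg → Cfg → ℚ
  P H T k x y = if zeroOffset y then downUp H k x y ÷' ℕ→ℚ T else downUp H k x y

  eqCfg : {m : ℕ} → Vec (Maybe V) m → Vec (Maybe V) m → Bool
  eqCfg Vec.[] Vec.[] = true
  eqCfg (a Vec.∷ g) (b Vec.∷ h) = eqM a b ∧ eqCfg g h

  R : (H T k : ℕ) → V → V → Cfg → Cfg → ℚ
  R H T k u c x y =
    if eqCfg x y
      then 1ℚ - sumℚ (map (λ z → if eqCfg x z then 0ℚ else P H T k x z) (Ωe k u c))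
      else P H T k x y

  πclaim : (H T k : ℕ) → Cfg → ℚ
  πclaim H T k x =
    (1ℚ ÷' ℕ→ℚ (s C suc k)) * ((1ℚ ÷' ℕ→ℚ 2) *
      ((if zeroOffset x then wJ H T k else ℕ→ℚ T * wI H T k)
        ÷' ((ℕ→ℚ (2 Data.Nat.^ k ∸ 1) * ℕ→ℚ T * wI H T k) + wJ H T k)))

IsStationaryDistribution : {S : Set} → List S → (S → S → ℚ) → (S → ℚ) → Set
IsStationaryDistribution Ω K π =
  (sumℚ (map π Ω) ≡ 1ℚ) ×
  (∀ y → y ∈ Ω → sumℚ (map (λ x → π x * K x y) Ω) ≡ π y)

module Submission where

-- R is the lazy restriction of the split chain P to Ω (off-diagonal moves as in
-- P, the missing mass stays put).  Hence π is stationary for R once it is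
-- normalised and P is reversible for π on Ω: π(x)P(x,y) = π(y)P(y,x).

open import Defs hiding (sym)
open import Data.Nat as ℕ using (ℕ; zero; suc; _≤_; _<_; z≤n; s≤s)
import Data.Nat.Properties as ℕP
open import Data.Nat.Combinatorics using (_C_; nCk+nC[k+1]≡[n+1]C[k+1])
open import Data.Bool using (Bool; true; false; _∧_; _∨_; if_then_else_)
import Data.Bool as Bool
import Data.Bool.Properties as BoolP
open import Data.Fin as Fin using (Fin)
import Data.Fin.Properties as FinP
open import Data.Maybe using (Maybe; just; nothing; is-just)
open import Data.List using (List; []; _∷_; map; filter; concatMap; length; _++_)
open import Data.Bool.ListAction using (all; any)
open import Data.Vec as Vec using (Vec; toList; lookup; _[_]≔_; allFin; tabulate)
import Data.Integer as ℤ
open import Data.Integer.Tactic.RingSolver using (solve-∀)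
open import Data.Rational using (ℚ; 0ℚ; 1ℚ; _+_; _*_; _-_; toℚᵘ)
import Data.Rational as ℚ
import Data.Rational.Properties as ℚP
import Data.Rational.Unnormalised as ℚᵘ
import Data.Rational.Unnormalised.Properties as ℚᵘP
open import Data.Rational.Solver using (module +-*-Solver)
open import Algebra.Bundles using (CommutativeRing)
open import Algebra.Properties.Semiring.Sum (CommutativeRing.semiring ℚP.+-*-commutativeRing)
  using (sum; sum-cong-≗; ∑-distrib-+; *-distribˡ-sum; sum-replicate-zero)
open import Relation.Binary.PropositionalEquality
open import Data.Product using (Σ; _×_; _,_; proj₁; proj₂)
open import Data.Sum using (_⊎_; inj₁; inj₂)
open import Data.Empty using (⊥; ⊥-elim)
open import Relation.Nullary using (yes; no; ⌊_⌋)
open import Data.List.Membership.Propositional using (_∈_)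
open import Data.List.Relation.Unary.Any using (here; there)
open import Data.List.Membership.Propositional.Properties using (∈-filter⁻)

open +-*-Solver

-- The embedding ℕ → ℚ of Defs is a semiring homomorphism (respecting truncated
-- subtraction below the diagonal); this is proved through the unnormalised
-- rationals, where the embedding is a plain constructor application.

ℕ→ℚ-toℚᵘ : ∀ m → toℚᵘ (ℕ→ℚ m) ℚᵘ.≃ ℚᵘ.mkℚᵘ (ℤ.+ m) 0
ℕ→ℚ-toℚᵘ m = ℚP.toℚᵘ-fromℚᵘ (ℚᵘ.mkℚᵘ (ℤ.+ m) 0)

ℕ→ℚ-suc : ∀ m → ℕ→ℚ (suc m) ≡ 1ℚ + ℕ→ℚ m
ℕ→ℚ-suc m = ℚP.toℚᵘ-injective (ℚᵘP.≃-trans (ℕ→ℚ-toℚᵘ (suc m)) (ℚᵘP.≃-trans unnormalised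
  (ℚᵘP.≃-sym (ℚᵘP.≃-trans (ℚP.toℚᵘ-homo-+ 1ℚ (ℕ→ℚ m)) (ℚᵘP.+-cong ℚᵘP.≃-refl (ℕ→ℚ-toℚᵘ m))))))
  where
  crossMultiplied : ∀ x → (ℤ.+ 1 ℤ.+ x) ℤ.* (ℤ.+ 1 ℤ.* ℤ.+ 1) ≡ (ℤ.+ 1 ℤ.* ℤ.+ 1 ℤ.+ x ℤ.* ℤ.+ 1) ℤ.* ℤ.+ 1
  crossMultiplied = solve-∀
  unnormalised : ℚᵘ.mkℚᵘ (ℤ.+ suc m) 0 ℚᵘ.≃ (ℚᵘ.mkℚᵘ (ℤ.+ 1) 0 ℚᵘ.+ ℚᵘ.mkℚᵘ (ℤ.+ m) 0)
  unnormalised = ℚᵘ.*≡* (crossMultiplied (ℤ.+ m))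

ℕ→ℚ-nonzero : ∀ {m} → 1 ≤ m → ℕ→ℚ m ≢ 0ℚ
ℕ→ℚ-nonzero {suc m} _ eq
  with ℚᵘP.≃-trans (ℚᵘP.≃-sym (ℕ→ℚ-toℚᵘ (suc m))) (ℚᵘP.≃-trans (ℚP.toℚᵘ-cong eq) (ℕ→ℚ-toℚᵘ 0))
... | ℚᵘ.*≡* ()

ℕ→ℚ-+ : ∀ a b → ℕ→ℚ (a ℕ.+ b) ≡ ℕ→ℚ a + ℕ→ℚ b
ℕ→ℚ-+ zero b = sym (ℚP.+-identityˡ (ℕ→ℚ b))
ℕ→ℚ-+ (suc a) b = begin
  ℕ→ℚ (suc (a ℕ.+ b))    ≡⟨ ℕ→ℚ-suc (a ℕ.+ b) ⟩
  1ℚ + ℕ→ℚ (a ℕ.+ b)     ≡⟨ cong (1ℚ +_) (ℕ→ℚ-+ a b) ⟩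
  1ℚ + (ℕ→ℚ a + ℕ→ℚ b)   ≡⟨ sym (ℚP.+-assoc 1ℚ (ℕ→ℚ a) (ℕ→ℚ b)) ⟩
  (1ℚ + ℕ→ℚ a) + ℕ→ℚ b   ≡⟨ cong (_+ ℕ→ℚ b) (sym (ℕ→ℚ-suc a)) ⟩
  ℕ→ℚ (suc a) + ℕ→ℚ b    ∎
  where open ≡-Reasoning

ℕ→ℚ-* : ∀ a b → ℕ→ℚ (a ℕ.* b) ≡ ℕ→ℚ a * ℕ→ℚ b
ℕ→ℚ-* zero b = sym (ℚP.*-zeroˡ (ℕ→ℚ b))
ℕ→ℚ-* (suc a) b = begin
  ℕ→ℚ (b ℕ.+ a ℕ.* b)      ≡⟨ ℕ→ℚ-+ b (a ℕ.* b) ⟩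
  ℕ→ℚ b + ℕ→ℚ (a ℕ.* b)    ≡⟨ cong (ℕ→ℚ b +_) (ℕ→ℚ-* a b) ⟩
  ℕ→ℚ b + ℕ→ℚ a * ℕ→ℚ b    ≡⟨ solve 2 (λ x y → y :+ x :* y := (con 1ℚ :+ x) :* y) refl (ℕ→ℚ a) (ℕ→ℚ b) ⟩
  (1ℚ + ℕ→ℚ a) * ℕ→ℚ b     ≡⟨ cong (_* ℕ→ℚ b) (sym (ℕ→ℚ-suc a)) ⟩
  ℕ→ℚ (suc a) * ℕ→ℚ b      ∎
  where open ≡-Reasoning

ℕ→ℚ-∸ : ∀ a b → b ≤ a → ℕ→ℚ (a ℕ.∸ b) ≡ ℕ→ℚ a - ℕ→ℚ b
ℕ→ℚ-∸ a zero _ = solve 1 (λ x → x := x :- con 0ℚ) refl (ℕ→ℚ a)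
ℕ→ℚ-∸ (suc a) (suc b) (s≤s b≤a) = begin
  ℕ→ℚ (a ℕ.∸ b)                 ≡⟨ ℕ→ℚ-∸ a b b≤a ⟩
  ℕ→ℚ a - ℕ→ℚ b                 ≡⟨ solve 2 (λ x y → x :- y := (con 1ℚ :+ x) :- (con 1ℚ :+ y)) refl (ℕ→ℚ a) (ℕ→ℚ b) ⟩
  (1ℚ + ℕ→ℚ a) - (1ℚ + ℕ→ℚ b)   ≡⟨ cong₂ _-_ (sym (ℕ→ℚ-suc a)) (sym (ℕ→ℚ-suc b)) ⟩
  ℕ→ℚ (suc a) - ℕ→ℚ (suc b)     ∎
  where open ≡-Reasoning

ℕ→ℚ-two : 1ℚ + 1ℚ ≡ ℕ→ℚ 2
ℕ→ℚ-two = sym (ℕ→ℚ-suc 1)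

÷'-as-* : ∀ p q → p ÷' q ≡ p * (1ℚ ÷' q)
÷'-as-* p q with q ℚP.≟ 0ℚ
... | yes _ = sym (ℚP.*-zeroʳ p)
... | no _  = cong (p *_) (sym (ℚP.*-identityˡ _))

÷'-inverse : ∀ q → q ≢ 0ℚ → q * (1ℚ ÷' q) ≡ 1ℚ
÷'-inverse q q≢0 with q ℚP.≟ 0ℚ
... | yes q≡0 = ⊥-elim (q≢0 q≡0)
... | no q≢0' = trans (cong (q *_) (ℚP.*-identityˡ _)) (ℚP.*-inverseʳ q {{ℚ.≢-nonZero q≢0'}})

-- (1/a)(1/b)(1/c) is the inverse of abc; this is how the normalising constant
-- of π cancels against the total count of states.
reciprocal-product : ∀ a b c → a ≢ 0ℚ → b ≢ 0ℚ → c ≢ 0ℚ →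
  ((1ℚ ÷' a) * ((1ℚ ÷' b) * (1ℚ ÷' c))) * ((a * b) * c) ≡ 1ℚ
reciprocal-product a b c a≢0 b≢0 c≢0 = trans
  (solve 6 (λ a b c ia ib ic → (ia :* (ib :* ic)) :* ((a :* b) :* c) := (a :* ia) :* ((b :* ib) :* (c :* ic)))
     refl a b c (1ℚ ÷' a) (1ℚ ÷' b) (1ℚ ÷' c))
  (cong₂ _*_ (÷'-inverse a a≢0) (cong₂ _*_ (÷'-inverse b b≢0) (÷'-inverse c c≢0)))

-- Powers in ℚ, for the counts 2^j and 1^j of words over a two- or one-letter
-- alphabet.
powℚ : ℚ → ℕ → ℚ
powℚ q zero    = 1ℚ
powℚ q (suc j) = q * powℚ q j

powℚ-two : ∀ j → powℚ (1ℚ + 1ℚ) j ≡ ℕ→ℚ (2 ℕ.^ j)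
powℚ-two zero    = refl
powℚ-two (suc j) = trans (cong₂ _*_ ℕ→ℚ-two (powℚ-two j)) (sym (ℕ→ℚ-* 2 (2 ℕ.^ j)))

powℚ-one : ∀ j → powℚ 1ℚ j ≡ 1ℚ
powℚ-one zero    = refl
powℚ-one (suc j) = trans (ℚP.*-identityˡ _) (powℚ-one j)

-- Binomial coefficients by Pascal's rule, which is the recursion the face
-- counts follow; they agree with the library's _C_.
binom : ℕ → ℕ → ℕ
binom zero    zero    = 1
binom zero    (suc j) = 0
binom (suc m) zero    = 1
binom (suc m) (suc j) = binom m j ℕ.+ binom m (suc j)

binom≡C : ∀ m j → binom m j ≡ m C j
binom≡C zero    zero    = refl
binom≡C zero    (suc j) = refl
binom≡C (suc m) zero    = refl
binom≡C (suc m) (suc j) =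
  trans (cong₂ ℕ._+_ (binom≡C m j) (binom≡C m (suc j))) (nCk+nC[k+1]≡[n+1]C[k+1] m j)

binom-positive : ∀ m j → j ≤ m → 1 ≤ binom m j
binom-positive zero    zero    _         = s≤s z≤n
binom-positive (suc m) zero    _         = s≤s z≤n
binom-positive (suc m) (suc j) (s≤s j≤m) = ℕP.≤-trans (binom-positive m j j≤m) (ℕP.m≤m+n _ _)

binom-zero : ∀ m → binom m 0 ≡ 1
binom-zero zero    = refl
binom-zero (suc m) = refl

∧-true : ∀ {a b} → (a ∧ b) ≡ true → a ≡ true × b ≡ true
∧-true {true} {true} _ = refl , refl

∨-true : ∀ {a b} → (a ∨ b) ≡ true → a ≡ true ⊎ b ≡ true
∨-true {true}          _ = inj₁ refl
∨-true {false} {true}  _ = inj₂ refl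

bool-ext : ∀ {b c : Bool} → (b ≡ true → c ≡ true) → (c ≡ true → b ≡ true) → b ≡ c
bool-ext {true}  {true}  _ _ = refl
bool-ext {false} {false} _ _ = refl
bool-ext {true}  {false} f _ = sym (f refl)
bool-ext {false} {true}  _ g = g refl

≡ᵇ-true : ∀ {a b} → (a ℕ.≡ᵇ b) ≡ true → a ≡ b
≡ᵇ-true {a} {b} e = ℕP.≡ᵇ⇒≡ a b (subst Bool.T (sym e) _)

≡ᵇ-false : ∀ a b → a ≢ b → (a ℕ.≡ᵇ b) ≡ false
≡ᵇ-false a b a≢b with a ℕ.≡ᵇ b in e
... | false = refl
... | true  = ⊥-elim (a≢b (≡ᵇ-true e))

false≢true : false ≢ true
false≢true ()

eqF : ∀ {m} → Fin m → Fin m → Bool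
eqF a b = ⌊ a Fin.≟ b ⌋

eqF-refl : ∀ {m} (a : Fin m) → eqF a a ≡ true
eqF-refl a with a Fin.≟ a
... | yes _  = refl
... | no a≢a = ⊥-elim (a≢a refl)

eqF-true : ∀ {m} {a b : Fin m} → eqF a b ≡ true → a ≡ b
eqF-true {a = a} {b} e with a Fin.≟ b
... | yes a≡b = a≡b

eqF-false : ∀ {m} {a b : Fin m} → eqF a b ≡ false → a ≢ b
eqF-false {a = a} e refl = false≢true (trans (sym e) (eqF-refl a))

eqF-sym : ∀ {m} (a b : Fin m) → eqF a b ≡ eqF b a
eqF-sym a b = bool-ext (λ e → subst (λ x → eqF x a ≡ true) (eqF-true e) (eqF-refl a))
                       (λ e → subst (λ x → eqF x b ≡ true) (eqF-true e) (eqF-refl b))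

eqF-suc : ∀ {m} (a b : Fin m) → eqF (Fin.suc a) (Fin.suc b) ≡ eqF a b
eqF-suc a b = bool-ext (λ e → subst (λ x → eqF a x ≡ true) (FinP.suc-injective (eqF-true e)) (eqF-refl a))
                       (λ e → subst (λ x → eqF (Fin.suc a) (Fin.suc x) ≡ true) (eqF-true e) (eqF-refl (Fin.suc a)))

ind : Bool → ℚ → ℚ
ind b x = if b then x else 0ℚ

ind-∧ : ∀ b c x → ind (b ∧ c) x ≡ ind b (ind c x)
ind-∧ true  c x = refl
ind-∧ false c x = refl

ind-comm : ∀ b c x → ind b (ind c x) ≡ ind c (ind b x)
ind-comm true  true  x = refl
ind-comm true  false x = refl
ind-comm false true  x = refl
ind-comm false false x = refl

ind-zero : ∀ b → ind b 0ℚ ≡ 0ℚ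
ind-zero true  = refl
ind-zero false = refl

ind-as-* : ∀ b x → ind b x ≡ x * ind b 1ℚ
ind-as-* true  x = sym (ℚP.*-identityʳ x)
ind-as-* false x = sym (ℚP.*-zeroʳ x)

ind-∨ : ∀ b c x → (b ≡ true → c ≡ true → ⊥) → ind (b ∨ c) x ≡ ind b x + ind c x
ind-∨ true  true  x disj = ⊥-elim (disj refl refl)
ind-∨ true  false x _    = sym (ℚP.+-identityʳ x)
ind-∨ false true  x _    = sym (ℚP.+-identityˡ x)
ind-∨ false false x _    = sym (ℚP.+-identityˡ 0ℚ)

ΣL : {A : Set} → List A → (A → ℚ) → ℚ
ΣL xs f = sumℚ (map f xs)

module _ {A : Set} where

  ΣL-cong : (xs : List A) {f g : A → ℚ} → (∀ x → f x ≡ g x) → ΣL xs f ≡ ΣL xs g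
  ΣL-cong []       eq = refl
  ΣL-cong (x ∷ xs) eq = cong₂ _+_ (eq x) (ΣL-cong xs eq)

  ΣL-cong∈ : (xs : List A) {f g : A → ℚ} → (∀ x → x ∈ xs → f x ≡ g x) → ΣL xs f ≡ ΣL xs g
  ΣL-cong∈ []       eq = refl
  ΣL-cong∈ (x ∷ xs) eq = cong₂ _+_ (eq x (here refl)) (ΣL-cong∈ xs (λ y y∈ → eq y (there y∈)))

  ΣL-zero : (xs : List A) → ΣL xs (λ _ → 0ℚ) ≡ 0ℚ
  ΣL-zero []       = refl
  ΣL-zero (x ∷ xs) = trans (ℚP.+-identityˡ _) (ΣL-zero xs)

  ΣL-+ : (xs : List A) (f g : A → ℚ) → ΣL xs (λ x → f x + g x) ≡ ΣL xs f + ΣL xs g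
  ΣL-+ []       f g = refl
  ΣL-+ (x ∷ xs) f g = trans (cong (λ t → (f x + g x) + t) (ΣL-+ xs f g))
    (solve 4 (λ a b c d → (a :+ b) :+ (c :+ d) := (a :+ c) :+ (b :+ d)) refl (f x) (g x) (ΣL xs f) (ΣL xs g))

  ΣL-* : (xs : List A) (c : ℚ) (f : A → ℚ) → ΣL xs (λ x → c * f x) ≡ c * ΣL xs f
  ΣL-* []       c f = sym (ℚP.*-zeroʳ c)
  ΣL-* (x ∷ xs) c f = trans (cong (c * f x +_) (ΣL-* xs c f)) (sym (ℚP.*-distribˡ-+ c (f x) (ΣL xs f)))

  ΣL-ind : (xs : List A) (b : Bool) (f : A → ℚ) → ΣL xs (λ x → ind b (f x)) ≡ ind b (ΣL xs f)
  ΣL-ind xs true  f = refl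
  ΣL-ind xs false f = ΣL-zero xs

  ΣL-filter : (xs : List A) (p : A → Bool) (f : A → ℚ) →
    ΣL (filter (λ x → p x Bool.≟ true) xs) f ≡ ΣL xs (λ x → ind (p x) (f x))
  ΣL-filter []       p f = refl
  ΣL-filter (x ∷ xs) p f with p x
  ... | true  = cong (f x +_) (ΣL-filter xs p f)
  ... | false = trans (ΣL-filter xs p f) (sym (ℚP.+-identityˡ _))

  ΣL-++ : (xs ys : List A) (f : A → ℚ) → ΣL (xs ++ ys) f ≡ ΣL xs f + ΣL ys f
  ΣL-++ []       ys f = sym (ℚP.+-identityˡ _)
  ΣL-++ (x ∷ xs) ys f = trans (cong (f x +_) (ΣL-++ xs ys f)) (sym (ℚP.+-assoc (f x) _ _))

  ΣL-count : (xs : List A) (p : A → Bool) (y : ℚ) →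
    ΣL xs (λ x → ind (p x) y) ≡ ℕ→ℚ (length (filter (λ x → p x Bool.≟ true) xs)) * y
  ΣL-count []       p y = sym (ℚP.*-zeroˡ y)
  ΣL-count (x ∷ xs) p y with p x
  ... | true  = trans (cong (y +_) (ΣL-count xs p y)) (trans
        (solve 2 (λ l y → y :+ l :* y := (con 1ℚ :+ l) :* y) refl (ℕ→ℚ (length (filter (λ x → p x Bool.≟ true) xs))) y)
        (cong (_* y) (sym (ℕ→ℚ-suc (length (filter (λ x → p x Bool.≟ true) xs))))))
  ... | false = trans (ℚP.+-identityˡ _) (ΣL-count xs p y)

ΣL-map : {A B : Set} (xs : List A) (g : A → B) (f : B → ℚ) → ΣL (map g xs) f ≡ ΣL xs (λ x → f (g x))
ΣL-map []       g f = refl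
ΣL-map (x ∷ xs) g f = cong (f (g x) +_) (ΣL-map xs g f)

ΣL-concatMap : {A B : Set} (xs : List A) (h : A → List B) (f : B → ℚ) →
  ΣL (concatMap h xs) f ≡ ΣL xs (λ x → ΣL (h x) f)
ΣL-concatMap []       h f = refl
ΣL-concatMap (x ∷ xs) h f = trans (ΣL-++ (h x) (concatMap h xs) f) (cong (ΣL (h x) f +_) (ΣL-concatMap xs h f))

ΣL-tabulate : {A : Set} → ∀ m (h : Fin m → A) (f : A → ℚ) → ΣL (toList (tabulate h)) f ≡ sum (λ i → f (h i))
ΣL-tabulate zero    h f = refl
ΣL-tabulate (suc m) h f = cong (f (h Fin.zero) +_) (ΣL-tabulate m (λ i → h (Fin.suc i)) f)

ΣL-allFin : ∀ m (f : Fin m → ℚ) → ΣL (toList (allFin m)) f ≡ sum f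
ΣL-allFin m f = ΣL-tabulate m (λ i → i) f

sum-delta : ∀ m (a : Fin m) (f : Fin m → ℚ) → sum (λ v → ind (eqF v a) (f v)) ≡ f a
sum-delta (suc m) Fin.zero f = trans (cong (f Fin.zero +_) (sum-replicate-zero m)) (ℚP.+-identityʳ _)
sum-delta (suc m) (Fin.suc a) f = trans (cong (0ℚ +_)
  (trans (sum-cong-≗ (λ i → cong (λ b → ind b (f (Fin.suc i))) (eqF-suc i a))) (sum-delta m a (λ i → f (Fin.suc i)))))
  (ℚP.+-identityˡ _)

sum-delta' : ∀ m (a : Fin m) (f : Fin m → ℚ) → sum (λ v → ind (eqF a v) (f v)) ≡ f a
sum-delta' m a f = trans (sum-cong-≗ (λ v → cong (λ b → ind b (f v)) (eqF-sym a v))) (sum-delta m a f)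

module _ {A : Set} where

  all-∈ : (p : A → Bool) (xs : List A) → all p xs ≡ true → ∀ {x} → x ∈ xs → p x ≡ true
  all-∈ p (y ∷ xs) e (here refl) = proj₁ (∧-true e)
  all-∈ p (y ∷ xs) e (there x∈)  = all-∈ p xs (proj₂ (∧-true {p y} e)) x∈

  all-intro : (p : A → Bool) (xs : List A) → (∀ {x} → x ∈ xs → p x ≡ true) → all p xs ≡ true
  all-intro p []       f = refl
  all-intro p (y ∷ xs) f rewrite f (here refl) = all-intro p xs (λ x∈ → f (there x∈))

  all-counterexample : (p : A → Bool) (xs : List A) → all p xs ≡ false → Σ A λ x → x ∈ xs × p x ≡ false
  all-counterexample p (y ∷ xs) e with p y in py
  ... | false = y , here refl , py
  ... | true  = let (x , x∈ , px) = all-counterexample p xs e in x , there x∈ , px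

  any-witness : (p : A → Bool) (xs : List A) → any p xs ≡ true → Σ A λ x → x ∈ xs × p x ≡ true
  any-witness p (y ∷ xs) e with p y in py
  ... | true  = y , here refl , py
  ... | false = let (x , x∈ , px) = any-witness p xs e in x , there x∈ , px

any-tabulate : ∀ {A : Set} {m} (f : Fin m → A) (p : A → Bool) (i : Fin m) → p (f i) ≡ true →
  any p (toList (tabulate f)) ≡ true
any-tabulate f p Fin.zero    e rewrite e = refl
any-tabulate f p (Fin.suc i) e rewrite any-tabulate (λ j → f (Fin.suc j)) p i e = BoolP.∨-zeroʳ (p (f Fin.zero))

filter-tabulate-nonempty : ∀ {A : Set} {m} (f : Fin m → A) (p : A → Bool) (i : Fin m) → p (f i) ≡ true →
  1 ≤ length (filter (λ x → p x Bool.≟ true) (toList (tabulate f)))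
filter-tabulate-nonempty f p Fin.zero    e rewrite e = s≤s z≤n
filter-tabulate-nonempty f p (Fin.suc i) e with p (f Fin.zero)
... | true  = s≤s z≤n
... | false = filter-tabulate-nonempty (λ j → f (Fin.suc j)) p i e

restrict : {S : Set} → List S → (S → S → Bool) → (S → S → ℚ) → S → S → ℚ
restrict Ω eq P x y = if eq x y then 1ℚ - ΣL Ω (λ z → if eq x z then 0ℚ else P x z) else P x y

-- Detailed balance on Ω makes π stationary for the lazy restriction; the
-- hypothesis on ΣL says that each state occurs once in Ω.
detailedBalance⇒stationary : {S : Set} (Ω : List S) (eq : S → S → Bool) (P : S → S → ℚ) (π : S → ℚ) →
  (∀ x y → eq x y ≡ eq y x) →
  (∀ {y} → y ∈ Ω → (f : S → ℚ) → ΣL Ω (λ x → ind (eq x y) (f x)) ≡ f y) →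
  (∀ {x y} → x ∈ Ω → y ∈ Ω → π x * P x y ≡ π y * P y x) →
  ∀ y → y ∈ Ω → ΣL Ω (λ x → π x * restrict Ω eq P x y) ≡ π y
detailedBalance⇒stationary {S} Ω eq P π eq-sym delta balance y y∈Ω = begin
  ΣL Ω (λ x → π x * restrict Ω eq P x y)
    ≡⟨ ΣL-cong Ω (λ x → split x (eq x y)) ⟩
  ΣL Ω (λ x → ind (eq x y) (π x * (1ℚ - out x)) + inflow x)
    ≡⟨ ΣL-+ Ω _ _ ⟩
  ΣL Ω (λ x → ind (eq x y) (π x * (1ℚ - out x))) + ΣL Ω inflow
    ≡⟨ cong₂ _+_ (delta y∈Ω (λ x → π x * (1ℚ - out x))) (ΣL-cong∈ Ω reverse) ⟩
  π y * (1ℚ - out y) + ΣL Ω (λ x → π y * (if eq y x then 0ℚ else P y x))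
    ≡⟨ cong (π y * (1ℚ - out y) +_) (ΣL-* Ω (π y) _) ⟩
  π y * (1ℚ - out y) + π y * out y
    ≡⟨ solve 2 (λ p q → p :* (con 1ℚ :- q) :+ p :* q := p) refl (π y) (out y) ⟩
  π y ∎
  where
  open ≡-Reasoning
  out : S → ℚ
  out x = ΣL Ω (λ z → if eq x z then 0ℚ else P x z)
  inflow : S → ℚ
  inflow x = if eq x y then 0ℚ else π x * P x y
  split : ∀ x e → π x * (if e then 1ℚ - out x else P x y) ≡ ind e (π x * (1ℚ - out x)) + (if e then 0ℚ else π x * P x y)
  split x true  = sym (ℚP.+-identityʳ _)
  split x false = sym (ℚP.+-identityˡ _)
  reverse : ∀ x → x ∈ Ω → inflow x ≡ π y * (if eq y x then 0ℚ else P y x)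
  reverse x x∈Ω = trans (cong (λ e → if e then 0ℚ else π x * P x y) (eq-sym x y)) (by-balance (eq y x))
    where
    by-balance : ∀ e → (if e then 0ℚ else π x * P x y) ≡ π y * (if e then 0ℚ else P y x)
    by-balance true  = sym (ℚP.*-zeroʳ (π y))
    by-balance false = balance x∈Ω y∈Ω

ind-∧-assoc : ∀ b c d x → ind ((b ∧ c) ∧ d) x ≡ ind b (ind (c ∧ d) x)
ind-∧-assoc b c d x = trans (cong (λ t → ind t x) (BoolP.∧-assoc b c d)) (ind-∧ b (c ∧ d) x)

ind-swap-guarded : ∀ a b l z → ind (a ∧ l) (ind b z) ≡ ind (b ∧ l) (ind a z)
ind-swap-guarded true  true  l     z = refl
ind-swap-guarded true  false true  z = refl
ind-swap-guarded true  false false z = refl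
ind-swap-guarded false true  true  z = refl
ind-swap-guarded false true  false z = refl
ind-swap-guarded false false l     z = refl

-- The summand of the normalisation of π, by the type of a configuration:
-- l (right size), io (admissible image), A (image in the edge), U, C (image
-- one endpoint of the edge), zo (0-offset).  For configurations of the right
-- size with image in the edge the image is admissible and 0-offset means U or
-- C, which exclude each other; the weight κ·(w_J or α) then splits as
-- κ·(α·[A] + (w_J − α)·([U] + [C])).
summand-by-type : ∀ (κ α wj : ℚ) (l io A U C zo : Bool) →
  (l ≡ true → U ≡ true → C ≡ true → ⊥) →
  (U ≡ true → A ≡ true) → (C ≡ true → A ≡ true) →
  (l ≡ true → A ≡ true → io ≡ true) →
  (l ≡ true → A ≡ true → zo ≡ (U ∨ C)) →
  ind (l ∧ io) (ind A (κ * (if zo then wj else α))) ≡ κ * (α * ind (l ∧ A) 1ℚ + (wj - α) * (ind (l ∧ U) 1ℚ + ind (l ∧ C) 1ℚ))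
summand-by-type κ α wj false io A U C zo _ _ _ _ _ = vanishes
  where
  vanishes : 0ℚ ≡ κ * (α * 0ℚ + (wj - α) * (0ℚ + 0ℚ))
  vanishes = solve 3 (λ K a w → con 0ℚ := K :* (a :* con 0ℚ :+ (w :- a) :* (con 0ℚ :+ con 0ℚ))) refl κ α wj
summand-by-type κ α wj true io false true  C     zo _ u→A _   _ _ = ⊥-elim (false≢true (u→A refl))
summand-by-type κ α wj true io false false true  zo _ _   c→A _ _ = ⊥-elim (false≢true (c→A refl))
summand-by-type κ α wj true io false false false zo _ _   _   _ _ = trans (ind-zero io)
  (solve 3 (λ K a w → con 0ℚ := K :* (a :* con 0ℚ :+ (w :- a) :* (con 0ℚ :+ con 0ℚ))) refl κ α wj)
summand-by-type κ α wj true io true  true  true  zo not-both _ _ _ _ = ⊥-elim (not-both refl refl refl)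
summand-by-type κ α wj true io true  true  false zo _ _ _ adm off with adm refl refl | off refl refl
... | refl | refl = solve 3 (λ K a w → K :* w := K :* (a :* con 1ℚ :+ (w :- a) :* (con 1ℚ :+ con 0ℚ))) refl κ α wj
summand-by-type κ α wj true io true  false true  zo _ _ _ adm off with adm refl refl | off refl refl
... | refl | refl = solve 3 (λ K a w → K :* w := K :* (a :* con 1ℚ :+ (w :- a) :* (con 0ℚ :+ con 1ℚ))) refl κ α wj
summand-by-type κ α wj true io true  false false zo _ _ _ adm off with adm refl refl | off refl refl
... | refl | refl = solve 3 (λ K a w → K :* a := K :* (a :* con 1ℚ :+ (w :- a) :* (con 0ℚ :+ con 0ℚ))) refl κ α wj

module FaceCombinatorics (G : Graph) (s : ℕ) where
  open Complex G s

  Slots : List (Maybe V)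
  Slots = nothing ∷ map just allV

  ΣCfg : (m : ℕ) → (Vec (Maybe V) m → ℚ) → ℚ
  ΣCfg m φ = ΣL (allVecs Slots m) φ

  ΣV : (V → ℚ) → ℚ
  ΣV = sum

  ΣV-cong : {f g : V → ℚ} → (∀ v → f v ≡ g v) → ΣV f ≡ ΣV g
  ΣV-cong = sum-cong-≗

  ΣV-+ : (f g : V → ℚ) → ΣV (λ v → f v + g v) ≡ ΣV f + ΣV g
  ΣV-+ = ∑-distrib-+

  ΣV-zero : ΣV (λ _ → 0ℚ) ≡ 0ℚ
  ΣV-zero = sum-replicate-zero (n G)

  ΣCfg-zero : ∀ m → ΣCfg m (λ _ → 0ℚ) ≡ 0ℚ
  ΣCfg-zero m = ΣL-zero (allVecs Slots m)

  size : ∀ {m} → Vec (Maybe V) m → ℕ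
  size g = length (values g)

  ΣCfg-cons : ∀ m (φ : Vec (Maybe V) (suc m) → ℚ) →
    ΣCfg (suc m) φ ≡ ΣCfg m (λ J → φ (nothing Vec.∷ J)) + ΣV (λ v → ΣCfg m (λ J → φ (just v Vec.∷ J)))
  ΣCfg-cons m φ = trans (ΣL-concatMap Slots (λ x → map (x Vec.∷_) (allVecs Slots m)) φ)
    (trans (ΣL-cong Slots (λ x → ΣL-map (allVecs Slots m) (x Vec.∷_) φ))
      (cong (ΣCfg m (λ J → φ (nothing Vec.∷ J)) +_)
        (trans (ΣL-map allV just _) (ΣL-allFin (n G) (λ v → ΣCfg m (λ J → φ (just v Vec.∷ J)))))))

  ΣCfg-delta : ∀ m (y : Vec (Maybe V) m) (φ : Vec (Maybe V) m → ℚ) → ΣCfg m (λ J → ind (eqCfg J y) (φ J)) ≡ φ y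
  ΣCfg-delta zero    Vec.[]         φ = ℚP.+-identityʳ _
  ΣCfg-delta (suc m) (a Vec.∷ y) φ = trans (ΣCfg-cons m _)
    (trans (cong₂ _+_ (firstEntry nothing) (ΣV-cong (λ v → firstEntry (just v)))) (headTerm a))
    where
    firstEntry : ∀ x → ΣCfg m (λ J → ind (eqM x a ∧ eqCfg J y) (φ (x Vec.∷ J))) ≡ ind (eqM x a) (φ (x Vec.∷ y))
    firstEntry x = trans (ΣL-cong (allVecs Slots m) (λ J → ind-∧ (eqM x a) (eqCfg J y) _))
      (trans (ΣL-ind (allVecs Slots m) (eqM x a) _) (cong (ind (eqM x a)) (ΣCfg-delta m y (λ J → φ (x Vec.∷ J)))))
    headTerm : ∀ a → ind (eqM nothing a) (φ (nothing Vec.∷ y)) + ΣV (λ v → ind (eqM (just v) a) (φ (just v Vec.∷ y)))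
                     ≡ φ (a Vec.∷ y)
    headTerm nothing  = trans (cong (φ (nothing Vec.∷ y) +_) ΣV-zero) (ℚP.+-identityʳ _)
    headTerm (just w) = trans (ℚP.+-identityˡ _) (sum-delta (n G) w (λ v → φ (just v Vec.∷ y)))

  subFace-size : ∀ {m} (g h : Vec (Maybe V) m) → subFace g h ≡ true → size g ≤ size h
  subFace-size Vec.[]             Vec.[]             e = z≤n
  subFace-size (nothing Vec.∷ g) (nothing Vec.∷ h)  e = subFace-size g h e
  subFace-size (nothing Vec.∷ g) (just x Vec.∷ h)   e = ℕP.m≤n⇒m≤1+n (subFace-size g h e)
  subFace-size (just a Vec.∷ g)  (just x Vec.∷ h)   e with eqV a x
  ... | true = s≤s (subFace-size g h e)

  superface-not-smaller : ∀ {m} (g J : Vec (Maybe V) m) → (subFace g J ∧ (suc (size J) ℕ.≡ᵇ size g)) ≡ false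
  superface-not-smaller g J with subFace g J in e
  ... | false = refl
  ... | true  = ≡ᵇ-false _ _ (λ eq → ℕP.<⇒≢ (s≤s (subFace-size g J e)) (sym eq))

  subface-not-larger : ∀ {m} (M x : Vec (Maybe V) m) → (subFace M x ∧ (size M ℕ.≡ᵇ suc (size x))) ≡ false
  subface-not-larger M x with subFace M x in e
  ... | false = refl
  ... | true  = ≡ᵇ-false _ _ (λ eq → ℕP.<⇒≢ (s≤s (subFace-size M x e)) eq)

  ΣV-pick : ∀ m (a : V) (c : V → Vec (Maybe V) m → Bool) (ψ : V → Vec (Maybe V) m → ℚ) →
    ΣV (λ v → ΣCfg m (λ J → ind (eqV a v) (ind (c v J) (ψ v J)))) ≡ ΣCfg m (λ J → ind (c a J) (ψ a J))
  ΣV-pick m a c ψ = trans (ΣV-cong (λ v → ΣL-ind (allVecs Slots m) (eqV a v) _))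
                          (sum-delta' (n G) a (λ v → ΣCfg m (λ J → ind (c v J) (ψ v J))))

  ΣV-pick' : ∀ m (a : V) (c : V → Vec (Maybe V) m → Bool) (ψ : V → Vec (Maybe V) m → ℚ) →
    ΣV (λ v → ΣCfg m (λ J → ind (eqV v a) (ind (c v J) (ψ v J)))) ≡ ΣCfg m (λ J → ind (c a J) (ψ a J))
  ΣV-pick' m a c ψ = trans (ΣV-cong (λ v → ΣL-ind (allVecs Slots m) (eqV v a) _))
                           (sum-delta (n G) a (λ v → ΣCfg m (λ J → ind (c v J) (ψ v J))))

  ΣCfg-superfaces-sameSize : ∀ m (g : Vec (Maybe V) m) (φ : Vec (Maybe V) m → ℚ) →
    ΣCfg m (λ J → ind (subFace g J ∧ (size J ℕ.≡ᵇ size g)) (φ J)) ≡ φ g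
  ΣCfg-superfaces-sameSize zero Vec.[] φ = ℚP.+-identityʳ _
  ΣCfg-superfaces-sameSize (suc m) (nothing Vec.∷ g) φ = trans (ΣCfg-cons m _)
    (trans (cong₂ _+_ (ΣCfg-superfaces-sameSize m g (λ J → φ (nothing Vec.∷ J)))
      (trans (ΣV-cong (λ v → trans (ΣL-cong (allVecs Slots m)
          (λ J → cong (λ b → ind b (φ (just v Vec.∷ J))) (superface-not-smaller g J))) (ΣCfg-zero m))) ΣV-zero))
      (ℚP.+-identityʳ _))
  ΣCfg-superfaces-sameSize (suc m) (just a Vec.∷ g) φ = trans (ΣCfg-cons m _)
    (trans (cong₂ _+_ (ΣCfg-zero m)
      (trans (ΣV-cong (λ v → ΣL-cong (allVecs Slots m) (λ J → ind-∧-assoc (eqV a v) (subFace g J) _ _)))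
        (trans (ΣV-pick m a (λ v J → subFace g J ∧ (size J ℕ.≡ᵇ size g)) (λ v J → φ (just v Vec.∷ J)))
          (ΣCfg-superfaces-sameSize m g (λ J → φ (just a Vec.∷ J))))))
      (ℚP.+-identityˡ _))

  ΣCfg-subfaces-sameSize : ∀ m (x : Vec (Maybe V) m) (ψ : Vec (Maybe V) m → ℚ) →
    ΣCfg m (λ M → ind (subFace M x ∧ (size M ℕ.≡ᵇ size x)) (ψ M)) ≡ ψ x
  ΣCfg-subfaces-sameSize zero Vec.[] ψ = ℚP.+-identityʳ _
  ΣCfg-subfaces-sameSize (suc m) (nothing Vec.∷ x) ψ = trans (ΣCfg-cons m _)
    (trans (cong₂ _+_ (ΣCfg-subfaces-sameSize m x (λ M → ψ (nothing Vec.∷ M)))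
      (trans (ΣV-cong (λ v → ΣCfg-zero m)) ΣV-zero))
      (ℚP.+-identityʳ _))
  ΣCfg-subfaces-sameSize (suc m) (just a Vec.∷ x) ψ = trans (ΣCfg-cons m _)
    (trans (cong₂ _+_
      (trans (ΣL-cong (allVecs Slots m) (λ M → cong (λ b → ind b (ψ (nothing Vec.∷ M))) (subface-not-larger M x)))
        (ΣCfg-zero m))
      (trans (ΣV-cong (λ v → ΣL-cong (allVecs Slots m) (λ M → ind-∧-assoc (eqV v a) (subFace M x) _ _)))
        (trans (ΣV-pick' m a (λ v M → subFace M x ∧ (size M ℕ.≡ᵇ size x)) (λ v M → ψ (just v Vec.∷ M)))
          (ΣCfg-subfaces-sameSize m x (λ M → ψ (just a Vec.∷ M))))))
      (ℚP.+-identityˡ _))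

  isFree : Maybe V → Bool
  isFree nothing  = true
  isFree (just _) = false

  ΣCfg-cofaces : ∀ m (g : Vec (Maybe V) m) (φ : Vec (Maybe V) m → ℚ) →
    ΣCfg m (λ J → ind (subFace g J ∧ (size J ℕ.≡ᵇ suc (size g))) (φ J))
      ≡ sum (λ b → ind (isFree (lookup g b)) (ΣV (λ v → φ (g [ b ]≔ just v))))
  ΣCfg-cofaces zero Vec.[] φ = ℚP.+-identityʳ _
  ΣCfg-cofaces (suc m) (nothing Vec.∷ g) φ = trans (ΣCfg-cons m _)
    (trans (cong₂ _+_ (ΣCfg-cofaces m g (λ J → φ (nothing Vec.∷ J)))
      (ΣV-cong (λ v → ΣCfg-superfaces-sameSize m g (λ J → φ (just v Vec.∷ J)))))
      (ℚP.+-comm _ (ΣV (λ v → φ (just v Vec.∷ g)))))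
  ΣCfg-cofaces (suc m) (just a Vec.∷ g) φ = trans (ΣCfg-cons m _) (cong₂ _+_ (ΣCfg-zero m)
    (trans (ΣV-cong (λ v → ΣL-cong (allVecs Slots m) (λ J → ind-∧-assoc (eqV a v) (subFace g J) _ _)))
      (trans (ΣV-pick m a (λ v J → subFace g J ∧ (size J ℕ.≡ᵇ suc (size g))) (λ v J → φ (just v Vec.∷ J)))
        (ΣCfg-cofaces m g (λ J → φ (just a Vec.∷ J))))))

  ΣCfg-facets : ∀ m (x : Vec (Maybe V) m) (ψ : Vec (Maybe V) m → ℚ) →
    ΣCfg m (λ M → ind (subFace M x ∧ (suc (size M) ℕ.≡ᵇ size x)) (ψ M))
      ≡ sum (λ b → ind (is-just (lookup x b)) (ψ (x [ b ]≔ nothing)))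
  ΣCfg-facets zero Vec.[] ψ = ℚP.+-identityʳ _
  ΣCfg-facets (suc m) (nothing Vec.∷ x) ψ = trans (ΣCfg-cons m _)
    (trans (cong₂ _+_ (ΣCfg-facets m x (λ M → ψ (nothing Vec.∷ M))) (trans (ΣV-cong (λ v → ΣCfg-zero m)) ΣV-zero))
      (trans (ℚP.+-identityʳ _) (sym (ℚP.+-identityˡ (sum (λ b → ind (is-just (lookup x b)) (ψ (nothing Vec.∷ (x [ b ]≔ nothing)))))))))
  ΣCfg-facets (suc m) (just a Vec.∷ x) ψ = trans (ΣCfg-cons m _) (cong₂ _+_
    (ΣCfg-subfaces-sameSize m x (λ M → ψ (nothing Vec.∷ M)))
    (trans (ΣV-cong (λ v → ΣL-cong (allVecs Slots m) (λ M → ind-∧-assoc (eqV v a) (subFace M x) _ _)))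
      (trans (ΣV-pick' m a (λ v M → subFace M x ∧ (suc (size M) ℕ.≡ᵇ size x)) (λ v M → ψ (just v Vec.∷ M)))
        (ΣCfg-facets m x (λ M → ψ (just a Vec.∷ M))))))

  -- configurations of size j with all values in p: choose the j positions,
  -- then a value satisfying p at each of them
  ΣCfg-count : ∀ (p : V → Bool) m j → ΣCfg m (λ J → ind ((size J ℕ.≡ᵇ j) ∧ all p (values J)) 1ℚ)
         ≡ ℕ→ℚ (binom m j) * powℚ (ΣV (λ v → ind (p v) 1ℚ)) j
  ΣCfg-count p zero zero = refl
  ΣCfg-count p zero (suc j) = trans (ℚP.+-identityʳ 0ℚ) (sym (ℚP.*-zeroˡ (powℚ (ΣV (λ v → ind (p v) 1ℚ)) (suc j))))
  ΣCfg-count p (suc m) zero = trans (ΣCfg-cons m _)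
    (trans (cong₂ _+_ (ΣCfg-count p m zero) (trans (ΣV-cong (λ v → ΣCfg-zero m)) ΣV-zero))
      (trans (ℚP.+-identityʳ _) (cong (λ t → ℕ→ℚ t * 1ℚ) (binom-zero m))))
  ΣCfg-count p (suc m) (suc j) = trans (ΣCfg-cons m _) (trans (cong₂ _+_ (ΣCfg-count p m (suc j))
      (trans (ΣV-cong (λ v → trans (ΣL-cong (allVecs Slots m) (λ J → pullValue (size J ℕ.≡ᵇ j) (p v) (all p (values J))))
                (trans (ΣL-ind (allVecs Slots m) (p v) _) (trans (cong (ind (p v)) (ΣCfg-count p m j)) (ind-as-* (p v) _)))))
        (sym (*-distribˡ-sum (ℕ→ℚ (binom m j) * powℚ q j) (λ v → ind (p v) 1ℚ)))))
    (trans (solve 4 (λ b₁ b₀ q qʲ → b₁ :* (q :* qʲ) :+ (b₀ :* qʲ) :* q := (b₀ :+ b₁) :* (q :* qʲ)) refl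
             (ℕ→ℚ (binom m (suc j))) (ℕ→ℚ (binom m j)) q (powℚ q j))
      (cong (_* powℚ q (suc j)) (sym (ℕ→ℚ-+ (binom m j) (binom m (suc j)))))))
    where
    q : ℚ
    q = ΣV (λ v → ind (p v) 1ℚ)
    pullValue : ∀ a b e → ind (a ∧ (b ∧ e)) 1ℚ ≡ ind b (ind (a ∧ e) 1ℚ)
    pullValue a b e = trans (ind-∧ a (b ∧ e) 1ℚ) (trans (cong (ind a) (ind-∧ b e 1ℚ))
                        (trans (ind-comm a b _) (cong (ind b) (sym (ind-∧ a e 1ℚ)))))

  inPair : V → V → V → Bool
  inPair a c x = eqV x a ∨ eqV x c

  inPair-sound : ∀ {a c x} → inPair a c x ≡ true → x ≡ a ⊎ x ≡ c
  inPair-sound {a} {c} {x} e with ∨-true {eqV x a} e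
  ... | inj₁ x≡a = inj₁ (eqF-true x≡a)
  ... | inj₂ x≡c = inj₂ (eqF-true x≡c)

  inPair-complete : ∀ {a c x} → x ≡ a ⊎ x ≡ c → inPair a c x ≡ true
  inPair-complete {a} {c} (inj₁ refl) rewrite eqF-refl a = refl
  inPair-complete {a} {c} (inj₂ refl) rewrite eqF-refl c = BoolP.∨-zeroʳ (eqV c a)

  all-inPair : ∀ {a c x} vs → all (inPair a c) vs ≡ true → x ∈ vs → x ≡ a ⊎ x ≡ c
  all-inPair {a} {c} {x} vs e x∈ = inPair-sound {a} {c} {x} (all-∈ (inPair a c) vs e x∈)

  ind-pair : ∀ {a c : V} → a ≢ c → (v : V) (y : ℚ) → ind (inPair a c v) y ≡ ind (eqV a v) y + ind (eqV c v) y
  ind-pair {a} {c} a≢c v y =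
    trans (ind-∨ (eqV v a) (eqV v c) y (λ e₁ e₂ → a≢c (trans (sym (eqF-true e₁)) (eqF-true e₂))))
          (cong₂ (λ p q → ind p y + ind q y) (eqF-sym v a) (eqF-sym v c))

  pair-within : ∀ {a c a' c' : V} → a ≢ c → (a ≡ a' ⊎ a ≡ c') → (c ≡ a' ⊎ c ≡ c') →
    ∀ {y} → (y ≡ a' ⊎ y ≡ c') → (y ≡ a ⊎ y ≡ c)
  pair-within a≢c (inj₁ p) (inj₁ q) _        = ⊥-elim (a≢c (trans p (sym q)))
  pair-within a≢c (inj₂ p) (inj₂ q) _        = ⊥-elim (a≢c (trans p (sym q)))
  pair-within a≢c (inj₁ p) (inj₂ q) (inj₁ y) = inj₁ (trans y (sym p))
  pair-within a≢c (inj₁ p) (inj₂ q) (inj₂ y) = inj₂ (trans y (sym q))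
  pair-within a≢c (inj₂ p) (inj₁ q) (inj₁ y) = inj₂ (trans y (sym q))
  pair-within a≢c (inj₂ p) (inj₁ q) (inj₂ y) = inj₁ (trans y (sym p))

  pair-adjacent : ∀ {a c a' c' : V} → adj G a' c' ≡ true → a ≢ c → (a ≡ a' ⊎ a ≡ c') → (c ≡ a' ⊎ c ≡ c') →
    adj G a c ≡ true
  pair-adjacent e a≢c (inj₁ p) (inj₁ q) = ⊥-elim (a≢c (trans p (sym q)))
  pair-adjacent e a≢c (inj₂ p) (inj₂ q) = ⊥-elim (a≢c (trans p (sym q)))
  pair-adjacent e a≢c (inj₁ refl) (inj₂ refl) = e
  pair-adjacent {a} {c} e a≢c (inj₂ refl) (inj₁ refl) = trans (Graph.sym G a c) e

  onEdge : List V → Bool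
  onEdge vs = any (λ a → any (λ c → adj G a c ∧ all (inPair a c) vs) allV) allV

  onEdge-witness : ∀ vs → onEdge vs ≡ true → Σ V λ a → Σ V λ c → adj G a c ≡ true × all (inPair a c) vs ≡ true
  onEdge-witness vs e with any-witness _ allV e
  ... | a , _ , e₂ with any-witness _ allV e₂
  ... | c , _ , e₃ = a , c , ∧-true e₃

  onEdge-intro : ∀ vs {a c} → adj G a c ≡ true → all (inPair a c) vs ≡ true → onEdge vs ≡ true
  onEdge-intro vs {a} {c} a~c all-ac =
    any-tabulate (λ i → i) _ a (any-tabulate (λ i → i) _ c (cong₂ _∧_ a~c all-ac))

  ΣV-neighbours : (a : V) (y : ℚ) → ΣV (λ w → ind (adj G a w) y) ≡ ℕ→ℚ (degree G a) * y
  ΣV-neighbours a y = trans (sym (ΣL-allFin (n G) (λ w → ind (adj G a w) y))) (ΣL-count allV (adj G a) y)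

  ∧-leftComm : ∀ a b c → (a ∧ (b ∧ c)) ≡ (b ∧ (a ∧ c))
  ∧-leftComm true  b     c = refl
  ∧-leftComm false true  c = refl
  ∧-leftComm false false c = refl

  all-fill : ∀ {m} (g : Vec (Maybe V) m) (b : Fin m) (v : V) (p : V → Bool) → lookup g b ≡ nothing →
    all p (values (g [ b ]≔ just v)) ≡ (p v ∧ all p (values g))
  all-fill (nothing Vec.∷ g) Fin.zero    v p e = refl
  all-fill (nothing Vec.∷ g) (Fin.suc b) v p e = all-fill g b v p e
  all-fill (just a Vec.∷ g)  (Fin.suc b) v p e = trans (cong (p a ∧_) (all-fill g b v p e)) (∧-leftComm (p a) (p v) _)

  ∈-fill : ∀ {m} (g : Vec (Maybe V) m) (b : Fin m) (v : V) {x : V} → lookup g b ≡ nothing →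
    x ∈ values g → x ∈ values (g [ b ]≔ just v)
  ∈-fill (nothing Vec.∷ g) Fin.zero    v e x∈        = there x∈
  ∈-fill (nothing Vec.∷ g) (Fin.suc b) v e x∈        = ∈-fill g b v e x∈
  ∈-fill (just a Vec.∷ g)  (Fin.suc b) v e (here p)  = here p
  ∈-fill (just a Vec.∷ g)  (Fin.suc b) v e (there x∈) = there (∈-fill g b v e x∈)

  allEqual-via : ∀ (vs : List V) {a} → a ∈ vs → allEqual vs ≡ all (eqV a) vs
  allEqual-via (h ∷ t) (here refl) = sym (cong (_∧ all (eqV h) t) (eqF-refl h))
  allEqual-via (h ∷ t) {a} (there a∈t) = bool-ext to from
    where
    to : all (eqV h) t ≡ true → (eqV a h ∧ all (eqV a) t) ≡ true
    to e with eqF-true (all-∈ (eqV h) t e a∈t)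
    ... | refl = trans (cong (_∧ all (eqV h) t) (eqF-refl h)) e
    from : (eqV a h ∧ all (eqV a) t) ≡ true → all (eqV h) t ≡ true
    from e with eqF-true (proj₁ (∧-true {eqV a h} e))
    ... | refl = proj₂ (∧-true {eqV a h} e)

  values-nonempty : ∀ (vs : List V) j → length vs ≡ suc j → Σ V λ a → a ∈ vs
  values-nonempty (x ∷ vs) j _ = x , here refl

  -- In a T-regular graph the admissible fillings are v = a, keeping
  -- a 0-offset face 0-offset, and then the T neighbours of a if g is 0-offset,
  -- or the other endpoint of the edge spanned by g otherwise.
  module Extension (T : ℕ) (regular : Regular G T) (g : Cfg) (b : Fin s) (b-free : lookup g b ≡ nothing)
                   (g-image : imageOK g ≡ true) (a : V) (a∈g : a ∈ values g) (X Y : ℚ) where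

    fill : V → Cfg
    fill v = g [ b ]≔ just v

    fill-zeroOffset : ∀ v → zeroOffset (fill v) ≡ (eqV a v ∧ zeroOffset g)
    fill-zeroOffset v = trans (allEqual-via (values (fill v)) (∈-fill g b v b-free a∈g))
      (trans (all-fill g b v (eqV a) b-free) (cong (eqV a v ∧_) (sym (allEqual-via (values g) a∈g))))

    fillOnEdge : V → Bool
    fillOnEdge v = onEdge (values (fill v))

    Summand : Bool → V → ℚ
    Summand z v = ind ((eqV a v ∧ z) ∨ fillOnEdge v) (if eqV a v ∧ z then X else Y)

    summand-form : ∀ v → ind (imageOK (fill v)) (if zeroOffset (fill v) then X else Y) ≡ Summand (zeroOffset g) v
    summand-form v = cong (λ z → ind (z ∨ fillOnEdge v) (if z then X else Y)) (fill-zeroOffset v)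

    module ZeroOffset (g-zero : zeroOffset g ≡ true) where
      g-all-a : all (eqV a) (values g) ≡ true
      g-all-a = trans (sym (allEqual-via (values g) a∈g)) g-zero

      fillOnEdge-neighbour : ∀ v → eqV a v ≡ false → fillOnEdge v ≡ adj G a v
      fillOnEdge-neighbour v a≠v = bool-ext to from
        where
        to : fillOnEdge v ≡ true → adj G a v ≡ true
        to e with onEdge-witness (values (fill v)) e
        ... | a' , c' , a'~c' , within =
          let v∈ , g∈ = ∧-true {inPair a' c' v} (trans (sym (all-fill g b v (inPair a' c') b-free)) within)
          in pair-adjacent a'~c' (eqF-false a≠v) (all-inPair (values g) g∈ a∈g)
                                                (inPair-sound {a'} {c'} {v} v∈)
        from : adj G a v ≡ true → fillOnEdge v ≡ true
        from a~v = onEdge-intro (values (fill v)) a~v (trans (all-fill g b v (inPair a v) b-free)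
          (cong₂ _∧_ (inPair-complete {a} {v} (inj₂ refl)) (all-intro (inPair a v) (values g)
            (λ {x} x∈ → inPair-complete {a} {v} {x} (inj₁ (sym (eqF-true (all-∈ (eqV a) (values g) g-all-a x∈))))))))

      summand : ∀ v → Summand true v ≡ ind (eqV a v) X + ind (adj G a v) Y
      summand v with eqV a v in a≟v
      ... | true with eqF-true a≟v
      ...   | refl = sym (trans (cong (λ t → X + ind t Y) (Graph.irrefl G a)) (ℚP.+-identityʳ X))
      summand v | false = trans (cong (λ t → ind t Y) (fillOnEdge-neighbour v a≟v)) (sym (ℚP.+-identityˡ _))

      total : ΣV (Summand true) ≡ X + ℕ→ℚ T * Y
      total = trans (ΣV-cong summand) (trans (ΣV-+ _ _)
        (cong₂ _+_ (sum-delta' (n G) a (λ _ → X)) (trans (ΣV-neighbours a Y) (cong (λ t → ℕ→ℚ t * Y) (regular a)))))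

    module SpansEdge (g-edge : zeroOffset g ≡ false) where
      otherWitness : Σ V λ x → x ∈ values g × eqV a x ≡ false
      otherWitness = all-counterexample (eqV a) (values g) (trans (sym (allEqual-via (values g) a∈g)) g-edge)

      other : V
      other = proj₁ otherWitness

      other∈g : other ∈ values g
      other∈g = proj₁ (proj₂ otherWitness)

      a≢other : a ≢ other
      a≢other = eqF-false (proj₂ (proj₂ otherWitness))

      edgeWitness : Σ V λ a' → Σ V λ c' → adj G a' c' ≡ true × all (inPair a' c') (values g) ≡ true
      edgeWitness = onEdge-witness (values g) (trans (sym (cong (_∨ onEdge (values g)) g-edge)) g-image)

      g-within : ∀ {x} → x ∈ values g → x ≡ a ⊎ x ≡ other
      g-within {x} x∈ with edgeWitness
      ... | a' , c' , _ , within = pair-within a≢other (all-inPair (values g) within a∈g)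
          (all-inPair (values g) within other∈g) (all-inPair (values g) within x∈)

      a~other : adj G a other ≡ true
      a~other with edgeWitness
      ... | a' , c' , a'~c' , within = pair-adjacent a'~c' a≢other
          (all-inPair (values g) within a∈g) (all-inPair (values g) within other∈g)

      fillOnEdge-pair : ∀ v → fillOnEdge v ≡ inPair a other v
      fillOnEdge-pair v = bool-ext to from
        where
        to : fillOnEdge v ≡ true → inPair a other v ≡ true
        to e with onEdge-witness (values (fill v)) e
        ... | a' , c' , _ , within =
          let v∈ , g∈ = ∧-true {inPair a' c' v} (trans (sym (all-fill g b v (inPair a' c') b-free)) within)
          in inPair-complete {a} {other} (pair-within a≢other (all-inPair (values g) g∈ a∈g)
               (all-inPair (values g) g∈ other∈g) (inPair-sound {a'} {c'} {v} v∈))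
        from : inPair a other v ≡ true → fillOnEdge v ≡ true
        from e = onEdge-intro (values (fill v)) a~other (trans (all-fill g b v (inPair a other) b-free)
          (cong₂ _∧_ e (all-intro (inPair a other) (values g) (λ {x} x∈ → inPair-complete {a} {other} {x} (g-within x∈)))))

      summand : ∀ v → Summand false v ≡ ind (eqV a v) Y + ind (eqV other v) Y
      summand v = trans (cong (λ z → ind (z ∨ fillOnEdge v) (if z then X else Y)) (BoolP.∧-zeroʳ (eqV a v)))
        (trans (cong (λ t → ind t Y) (fillOnEdge-pair v)) (ind-pair a≢other v Y))

      total : ΣV (Summand false) ≡ Y + Y
      total = trans (ΣV-cong summand) (trans (ΣV-+ _ _)
        (cong₂ _+_ (sum-delta' (n G) a (λ _ → Y)) (sum-delta' (n G) other (λ _ → Y))))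

    sum-over-fillings : ΣV (λ v → ind (imageOK (fill v)) (if zeroOffset (fill v) then X else Y))
                        ≡ (if zeroOffset g then X + ℕ→ℚ T * Y else Y + Y)
    sum-over-fillings = trans (ΣV-cong summand-form) (by-offset (zeroOffset g) refl)
      where
      by-offset : ∀ z → zeroOffset g ≡ z → ΣV (Summand z) ≡ (if z then X + ℕ→ℚ T * Y else Y + Y)
      by-offset true  e = ZeroOffset.total e
      by-offset false e = SpansEdge.total e

  freeCount : ∀ {m} → Vec (Maybe V) m → ℕ
  freeCount Vec.[]             = 0
  freeCount (nothing Vec.∷ g)  = suc (freeCount g)
  freeCount (just _ Vec.∷ g)   = freeCount g

  freeCount+size : ∀ {m} (g : Vec (Maybe V) m) → freeCount g ℕ.+ size g ≡ m
  freeCount+size Vec.[]            = refl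
  freeCount+size (nothing Vec.∷ g) = cong suc (freeCount+size g)
  freeCount+size (just _ Vec.∷ g)  = trans (ℕP.+-suc (freeCount g) (size g)) (cong suc (freeCount+size g))

  sum-free : ∀ m (g : Vec (Maybe V) m) (z : ℚ) → sum (λ b → ind (isFree (lookup g b)) z) ≡ ℕ→ℚ (freeCount g) * z
  sum-free zero    Vec.[]            z = sym (ℚP.*-zeroˡ z)
  sum-free (suc m) (nothing Vec.∷ g) z = trans (cong (z +_) (sum-free m g z))
    (trans (solve 2 (λ l y → y :+ l :* y := (con 1ℚ :+ l) :* y) refl (ℕ→ℚ (freeCount g)) z)
           (cong (_* z) (sym (ℕ→ℚ-suc (freeCount g)))))
  sum-free (suc m) (just _ Vec.∷ g)  z = trans (ℚP.+-identityˡ _) (sum-free m g z)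

  ind-rearrange : ∀ (a b c : Bool) (x y : ℚ) → (a ≡ true → b ≡ true → c ≡ true → x ≡ y) →
    ind (b ∧ c) (ind a x) ≡ ind (a ∧ b) (ind c y)
  ind-rearrange true  true  true  x y f = f refl refl refl
  ind-rearrange true  true  false x y f = refl
  ind-rearrange true  false c     x y f = refl
  ind-rearrange false true  true  x y f = refl
  ind-rearrange false true  false x y f = refl
  ind-rearrange false false c     x y f = refl

  -- A j-face in a complex of top dimension j + d, with r = s - (j+1)
  -- free positions, has weight Wvertex d r if it is 0-offset and Wedge d r
  -- otherwise; the recursion is the one of Extension: r free positions, each
  -- with 1 + T fillings (one 0-offset) for a 0-offset face, 2 otherwise.
  module Weights (T : ℕ) where

    Wedge : ℕ → ℕ → ℚ
    Wedge zero    r = 1ℚ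
    Wedge (suc d) r = ℕ→ℚ r * (Wedge d (ℕ.pred r) + Wedge d (ℕ.pred r))

    Wvertex : ℕ → ℕ → ℚ
    Wvertex zero    r = 1ℚ
    Wvertex (suc d) r = ℕ→ℚ r * (Wvertex d (ℕ.pred r) + ℕ→ℚ T * Wedge d (ℕ.pred r))

    Wclosed : ℕ → ℕ → Cfg → ℚ
    Wclosed d j g = if zeroOffset g then Wvertex d (s ℕ.∸ suc j) else Wedge d (s ℕ.∸ suc j)

    weight-closedForm : Regular G T → ∀ d j (g : Cfg) → isFace j g ≡ true → wAux d j g ≡ Wclosed d j g
    weight-closedForm regular zero j g _ with zeroOffset g
    ... | true  = refl
    ... | false = refl
    weight-closedForm regular (suc d) j g g-face = begin
      wAux (suc d) j g
        ≡⟨ ΣL-filter allCfg (isFace (suc j)) (λ J → ind (subFace g J) (wAux d (suc j) J)) ⟩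
      ΣCfg s (λ J → ind (isFace (suc j) J) (ind (subFace g J) (wAux d (suc j) J)))
        ≡⟨ ΣL-cong allCfg (λ J → ind-rearrange (subFace g J) (size J ℕ.≡ᵇ suc (suc j)) (imageOK J) _ _
                  (λ _ e₁ e₂ → weight-closedForm regular d (suc j) J (cong₂ _∧_ e₁ e₂))) ⟩
      ΣCfg s (λ J → ind (subFace g J ∧ (size J ℕ.≡ᵇ suc (suc j))) (φ J))
        ≡⟨ cong (λ t → ΣCfg s (λ J → ind (subFace g J ∧ (size J ℕ.≡ᵇ suc t)) (φ J))) (sym g-size) ⟩
      ΣCfg s (λ J → ind (subFace g J ∧ (size J ℕ.≡ᵇ suc (size g))) (φ J))
        ≡⟨ ΣCfg-cofaces s g φ ⟩
      sum (λ b → ind (isFree (lookup g b)) (ΣV (λ v → φ (g [ b ]≔ just v))))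
        ≡⟨ sum-cong-≗ fillings ⟩
      sum (λ b → ind (isFree (lookup g b)) Z)
        ≡⟨ sum-free s g Z ⟩
      ℕ→ℚ (freeCount g) * Z
        ≡⟨ cong (λ t → ℕ→ℚ t * Z) free-positions ⟩
      ℕ→ℚ r * Z
        ≡⟨ closed-step ⟩
      Wclosed (suc d) j g ∎
      where
      open ≡-Reasoning
      g-size : size g ≡ suc j
      g-size = ≡ᵇ-true (proj₁ (∧-true {size g ℕ.≡ᵇ suc j} g-face))
      g-image : imageOK g ≡ true
      g-image = proj₂ (∧-true {size g ℕ.≡ᵇ suc j} g-face)
      r r' : ℕ
      r  = s ℕ.∸ suc j
      r' = s ℕ.∸ suc (suc j)
      φ : Cfg → ℚ
      φ J = ind (imageOK J) (Wclosed d (suc j) J)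
      Z : ℚ
      Z = if zeroOffset g then Wvertex d r' + ℕ→ℚ T * Wedge d r' else Wedge d r' + Wedge d r'
      fillings : ∀ b → ind (isFree (lookup g b)) (ΣV (λ v → φ (g [ b ]≔ just v))) ≡ ind (isFree (lookup g b)) Z
      fillings b with lookup g b in b-free
      ... | nothing = let (a , a∈g) = values-nonempty (values g) j g-size
                      in Extension.sum-over-fillings T regular g b b-free g-image a a∈g (Wvertex d r') (Wedge d r')
      ... | just _  = refl
      free-positions : freeCount g ≡ r
      free-positions = trans (sym (ℕP.m+n∸n≡m (freeCount g) (size g))) (cong₂ ℕ._∸_ (freeCount+size g) g-size)
      closed-step : ℕ→ℚ r * Z ≡ Wclosed (suc d) j g
      closed-step rewrite ℕP.pred[m∸n]≡m∸[1+n] s (suc j) with zeroOffset g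
      ... | true  = refl
      ... | false = refl

    falling : ℕ → ℕ → ℚ
    falling zero    r = 1ℚ
    falling (suc d) r = ℕ→ℚ r * falling d (ℕ.pred r)

    pow2 : ℕ → ℚ
    pow2 d = ℕ→ℚ (2 ℕ.^ d)

    pow2-suc : ∀ d → pow2 (suc d) ≡ pow2 d + pow2 d
    pow2-suc d = trans (ℕ→ℚ-* 2 (2 ℕ.^ d)) (trans (cong (_* pow2 d) (sym ℕ→ℚ-two))
      (solve 1 (λ p → (con 1ℚ :+ con 1ℚ) :* p := p :+ p) refl (pow2 d)))

    vertexCoeff : ℕ → ℚ
    vertexCoeff d = ℕ→ℚ T * pow2 d - ℕ→ℚ T + 1ℚ

    Wedge-closed : ∀ d r → Wedge d r ≡ pow2 d * falling d r
    Wedge-closed zero    r = sym (ℚP.*-identityˡ 1ℚ)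
    Wedge-closed (suc d) r = trans (cong (λ t → ℕ→ℚ r * (t + t)) (Wedge-closed d (ℕ.pred r)))
      (trans (solve 3 (λ x p f → x :* (p :* f :+ p :* f) := (p :+ p) :* (x :* f)) refl (ℕ→ℚ r) (pow2 d) (falling d (ℕ.pred r)))
        (cong (_* falling (suc d) r) (sym (pow2-suc d))))

    Wvertex-closed : ∀ d r → Wvertex d r ≡ vertexCoeff d * falling d r
    Wvertex-closed zero r = trans (sym (ℚP.*-identityˡ 1ℚ))
      (cong (_* 1ℚ) (solve 1 (λ t → con 1ℚ := t :* con 1ℚ :- t :+ con 1ℚ) refl (ℕ→ℚ T)))
    Wvertex-closed (suc d) r = trans (cong₂ (λ p q → ℕ→ℚ r * (p + ℕ→ℚ T * q)) (Wvertex-closed d (ℕ.pred r)) (Wedge-closed d (ℕ.pred r)))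
      (trans (solve 4 (λ x t p f → x :* ((t :* p :- t :+ con 1ℚ) :* f :+ t :* (p :* f))
                                  := (t :* (p :+ p) :- t :+ con 1ℚ) :* (x :* f)) refl
               (ℕ→ℚ r) (ℕ→ℚ T) (pow2 d) (falling d (ℕ.pred r)))
        (cong (λ q → (ℕ→ℚ T * q - ℕ→ℚ T + 1ℚ) * falling (suc d) r) (sym (pow2-suc d))))

    weight-ratio : ∀ H k → let d = H ℕ.∸ k ; r = s ℕ.∸ suc k in wJ H T k * Wedge d r ≡ wI H T k * Wvertex d r
    weight-ratio H k = trans (cong₂ _*_ wJ-form (Wedge-closed d r)) (trans
      (solve 4 (λ a x p f → (a :* x) :* (p :* f) := (a :* p) :* (x :* f)) refl (ℕ→ℚ A) (vertexCoeff d) (pow2 d) (falling d r))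
      (sym (cong₂ _*_ wI-form (Wvertex-closed d r))))
      where
      d r A : ℕ
      d = H ℕ.∸ k
      r = s ℕ.∸ suc k
      A = d ℕ.! ℕ.* ((s ℕ.∸ k ℕ.∸ 1) C d)
      wI-form : wI H T k ≡ ℕ→ℚ A * pow2 d
      wI-form = ℕ→ℚ-* A (2 ℕ.^ d)
      T≤T2^d : T ≤ T ℕ.* 2 ℕ.^ d
      T≤T2^d = subst (_≤ T ℕ.* 2 ℕ.^ d) (ℕP.*-identityʳ T) (ℕP.*-monoʳ-≤ T (ℕP.m^n>0 2 d))
      wJ-form : wJ H T k ≡ ℕ→ℚ A * vertexCoeff d
      wJ-form = trans (ℕ→ℚ-* A _) (cong (ℕ→ℚ A *_) (trans (ℕ→ℚ-+ (T ℕ.* 2 ℕ.^ d ℕ.∸ T) 1)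
        (cong (_+ 1ℚ) (trans (ℕ→ℚ-∸ _ T T≤T2^d) (cong (_- ℕ→ℚ T) (ℕ→ℚ-* T (2 ℕ.^ d)))))))

  eqM-sym : (a b : Maybe V) → eqM a b ≡ eqM b a
  eqM-sym nothing  nothing  = refl
  eqM-sym nothing  (just _) = refl
  eqM-sym (just _) nothing  = refl
  eqM-sym (just a) (just b) = eqF-sym a b

  eqCfg-sym : ∀ {m} (x y : Vec (Maybe V) m) → eqCfg x y ≡ eqCfg y x
  eqCfg-sym Vec.[]         Vec.[]         = refl
  eqCfg-sym (a Vec.∷ x) (b Vec.∷ y) = cong₂ _∧_ (eqM-sym a b) (eqCfg-sym x y)

  allEqual-onPair : ∀ {u c : V} → u ≢ c → ∀ vs → all (inPair u c) vs ≡ true → (Σ V λ a → a ∈ vs) →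
    allEqual vs ≡ (all (eqV u) vs ∨ all (eqV c) vs)
  allEqual-onPair {u} {c} u≢c vs within (a , a∈) with all-inPair vs within a∈
  ... | inj₁ refl with all (eqV c) vs in all-c
  ...   | false = trans (allEqual-via vs a∈) (sym (BoolP.∨-identityʳ _))
  ...   | true  = ⊥-elim (u≢c (sym (eqF-true (all-∈ (eqV c) vs all-c a∈))))
  allEqual-onPair {u} {c} u≢c vs within (a , a∈) | inj₂ refl with all (eqV u) vs in all-u
  ...   | false = allEqual-via vs a∈
  ...   | true  = ⊥-elim (u≢c (eqF-true (all-∈ (eqV u) vs all-u a∈)))

  -- The chain on Ω_e for the edge e = {u, c}: detailed balance and
  -- normalisation of π.
  module OnEdge (H T k : ℕ) (regular : Regular G T) (k<H : k < H) (H+1≤s : H ℕ.+ 1 ≤ s)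
                (u c : V) (u~c : adj G u c ≡ true) where
    open Weights T

    d r : ℕ
    d = H ℕ.∸ k
    r = s ℕ.∸ suc k

    Ω : List Cfg
    Ω = Ωe k u c

    π : Cfg → ℚ
    π = πclaim H T k

    onUC : Cfg → Bool
    onUC x = all (inPair u c) (values x)

    Ω-membership : ∀ {x} → x ∈ Ω → isFace k x ≡ true × onUC x ≡ true
    Ω-membership x∈ =
      let (x∈faces , x-onUC) = ∈-filter⁻ (λ g → onUC g Bool.≟ true) {xs = faces k} x∈
      in proj₂ (∈-filter⁻ (λ g → isFace k g Bool.≟ true) {xs = allCfg} x∈faces) , x-onUC

    Ω-size : ∀ {x} → x ∈ Ω → size x ≡ suc k
    Ω-size {x} x∈ = ≡ᵇ-true (proj₁ (∧-true {size x ℕ.≡ᵇ suc k} (proj₁ (Ω-membership x∈))))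

    ΣΩ : ∀ f → ΣL Ω f ≡ ΣCfg s (λ x → ind (isFace k x) (ind (onUC x) (f x)))
    ΣΩ f = trans (ΣL-filter (faces k) onUC f) (ΣL-filter allCfg (isFace k) _)

    Ω-delta : ∀ {y} → y ∈ Ω → (f : Cfg → ℚ) → ΣL Ω (λ x → ind (eqCfg x y) (f x)) ≡ f y
    Ω-delta {y} y∈ f = trans (ΣΩ _)
      (trans (ΣL-cong allCfg (λ x → delta-outermost (isFace k x) (onUC x) (eqCfg x y) (f x)))
        (trans (ΣCfg-delta s y (λ x → ind (isFace k x) (ind (onUC x) (f x))))
          (cong₂ (λ a b → ind a (ind b (f y))) (proj₁ (Ω-membership y∈)) (proj₂ (Ω-membership y∈)))))
      where
      delta-outermost : ∀ a b e z → ind a (ind b (ind e z)) ≡ ind e (ind a (ind b z))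
      delta-outermost a b e z = trans (cong (ind a) (ind-comm b e z)) (ind-comm a e (ind b z))

    D : ℚ
    D = ℕ→ℚ (2 ℕ.^ k ℕ.∸ 1) * ℕ→ℚ T * wI H T k + wJ H T k

    κ : ℚ
    κ = (1ℚ ÷' ℕ→ℚ (s C suc k)) * ((1ℚ ÷' ℕ→ℚ 2) * (1ℚ ÷' D))

    massOf : Bool → ℚ
    massOf z = if z then wJ H T k else ℕ→ℚ T * wI H T k

    π-factor : ∀ x → π x ≡ κ * massOf (zeroOffset x)
    π-factor x = trans (cong (λ t → (1ℚ ÷' ℕ→ℚ (s C suc k)) * ((1ℚ ÷' ℕ→ℚ 2) * t)) (÷'-as-* (massOf (zeroOffset x)) D))
      (solve 4 (λ a b p e → a :* (b :* (p :* e)) := (a :* (b :* e)) :* p) refl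
        (1ℚ ÷' ℕ→ℚ (s C suc k)) (1ℚ ÷' ℕ→ℚ 2) (massOf (zeroOffset x)) (1ℚ ÷' D))

    T-nonzero : ℕ→ℚ T ≢ 0ℚ
    T-nonzero = ℕ→ℚ-nonzero (subst (1 ≤_) (regular u) (filter-tabulate-nonempty (λ i → i) (adj G u) c u~c))

    H≤s : H ≤ s
    H≤s = ℕP.≤-trans (ℕP.m≤m+n H 1) H+1≤s

    binom-nonzero : ℕ→ℚ (s C suc k) ≢ 0ℚ
    binom-nonzero = subst (λ t → ℕ→ℚ t ≢ 0ℚ) (binom≡C s (suc k))
      (ℕ→ℚ-nonzero (binom-positive s (suc k) (ℕP.≤-trans k<H H≤s)))

    D-nonzero : D ≢ 0ℚ
    D-nonzero D≡0 = ℕ→ℚ-nonzero (ℕP.≤-trans wJ-positive (ℕP.m≤n+m wJₙ ((2 ℕ.^ k ℕ.∸ 1) ℕ.* T ℕ.* wIₙ))) (trans D-as-ℕ D≡0)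
      where
      A wIₙ wJₙ : ℕ
      A   = d ℕ.! ℕ.* ((s ℕ.∸ k ℕ.∸ 1) C d)
      wIₙ = A ℕ.* 2 ℕ.^ d
      wJₙ = A ℕ.* (T ℕ.* 2 ℕ.^ d ℕ.∸ T ℕ.+ 1)
      d≤s-k-1 : d ≤ s ℕ.∸ k ℕ.∸ 1
      d≤s-k-1 = subst (d ≤_) (trans (ℕP.∸-+-assoc s 1 k) (trans (cong (s ℕ.∸_) (ℕP.+-comm 1 k)) (sym (ℕP.∸-+-assoc s k 1))))
        (ℕP.∸-monoˡ-≤ k (ℕP.m+n≤o⇒m≤o∸n H H+1≤s))
      A-positive : 1 ≤ A
      A-positive = ℕP.*-mono-≤ (ℕP.1≤n! d) (subst (1 ≤_) (binom≡C (s ℕ.∸ k ℕ.∸ 1) d) (binom-positive _ d d≤s-k-1))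
      wJ-positive : 1 ≤ wJₙ
      wJ-positive = ℕP.*-mono-≤ A-positive (ℕP.m≤n+m 1 (T ℕ.* 2 ℕ.^ d ℕ.∸ T))
      D-as-ℕ : ℕ→ℚ ((2 ℕ.^ k ℕ.∸ 1) ℕ.* T ℕ.* wIₙ ℕ.+ wJₙ) ≡ D
      D-as-ℕ = trans (ℕ→ℚ-+ ((2 ℕ.^ k ℕ.∸ 1) ℕ.* T ℕ.* wIₙ) wJₙ) (cong (_+ ℕ→ℚ wJₙ)
        (trans (ℕ→ℚ-* ((2 ℕ.^ k ℕ.∸ 1) ℕ.* T) wIₙ) (cong (_* ℕ→ℚ wIₙ) (ℕ→ℚ-* (2 ℕ.^ k ℕ.∸ 1) T))))

    -- The down-up walk is ρ · w(target) · (Σ over common facets M of 1/w(M)),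
    -- with ρ = 1/(k+1); the last factor is symmetric in source and target.
    ρ : ℚ
    ρ = 1ℚ ÷' ℕ→ℚ (suc k)

    facetKernel : Cfg → Cfg → ℚ
    facetKernel x y =
      ΣCfg s (λ M → ind (subFace M x ∧ (suc (size M) ℕ.≡ᵇ size x)) (ind (subFace M y) (1ℚ ÷' w H (k ℕ.∸ 1) M)))

    downUp-factor : ∀ x y → downUp H k x y ≡ ρ * (w H k y * facetKernel x y)
    downUp-factor x y = begin
      downUp H k x y
        ≡⟨ ΣL-cong (support x) (λ b → cong (ρ *_) (guarded-ratio (subFace (remove x b) y) (w H k y) (w H (k ℕ.∸ 1) (remove x b)))) ⟩
      ΣL (support x) (λ b → ρ * (w H k y * ψ (remove x b)))
        ≡⟨ ΣL-* (support x) ρ _ ⟩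
      ρ * ΣL (support x) (λ b → w H k y * ψ (remove x b))
        ≡⟨ cong (ρ *_) (ΣL-* (support x) (w H k y) _) ⟩
      ρ * (w H k y * ΣL (support x) (λ b → ψ (remove x b)))
        ≡⟨ cong (λ t → ρ * (w H k y * t)) (trans (ΣL-filter (toList (allFin s)) (λ b → is-just (lookup x b)) _)
              (trans (ΣL-allFin s _) (sym (ΣCfg-facets s x ψ)))) ⟩
      ρ * (w H k y * facetKernel x y) ∎
      where
      open ≡-Reasoning
      ψ : Cfg → ℚ
      ψ M = ind (subFace M y) (1ℚ ÷' w H (k ℕ.∸ 1) M)
      guarded-ratio : ∀ (e : Bool) (a q : ℚ) → (if e then a ÷' q else 0ℚ) ≡ a * ind e (1ℚ ÷' q)
      guarded-ratio true  a q = ÷'-as-* a q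
      guarded-ratio false a q = sym (ℚP.*-zeroʳ a)

    facetKernel-sym : ∀ {x y} → size x ≡ size y → facetKernel x y ≡ facetKernel y x
    facetKernel-sym {x} {y} same = ΣL-cong allCfg (λ M → swap (subFace M x) (subFace M y) (suc (size M)) same _)
      where
      swap : ∀ a b l {lx ly} → lx ≡ ly → ∀ z → ind (a ∧ (l ℕ.≡ᵇ lx)) (ind b z) ≡ ind (b ∧ (l ℕ.≡ᵇ ly)) (ind a z)
      swap a b l {lx} refl z = ind-swap-guarded a b (l ℕ.≡ᵇ lx) z

    targetFactor : Bool → ℚ
    targetFactor z = if z then 1ℚ ÷' ℕ→ℚ T else 1ℚ

    P-factor : ∀ x y → P H T k x y ≡ targetFactor (zeroOffset y) * downUp H k x y
    P-factor x y = scaled (zeroOffset y) (downUp H k x y)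
      where
      scaled : ∀ e q → (if e then q ÷' ℕ→ℚ T else q) ≡ targetFactor e * q
      scaled true  q = trans (÷'-as-* q (ℕ→ℚ T)) (ℚP.*-comm q _)
      scaled false q = sym (ℚP.*-identityˡ q)

    stateWeight : Bool → ℚ
    stateWeight z = if z then Wvertex d r else Wedge d r

    Ω-weight : ∀ {y} → y ∈ Ω → w H k y ≡ stateWeight (zeroOffset y)
    Ω-weight y∈ = weight-closedForm regular d k _ (proj₁ (Ω-membership y∈))

    -- the type-dependent part of the flow π(x)P(x,y) is symmetric: this is
    -- where the ratio identity enters
    flowFactor : Bool → Bool → ℚ
    flowFactor zx zy = massOf zx * (targetFactor zy * stateWeight zy)

    flowFactor-sym : ∀ zx zy → flowFactor zx zy ≡ flowFactor zy zx
    flowFactor-sym true  true  = refl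
    flowFactor-sym false false = refl
    flowFactor-sym true  false = vertex-to-edge
      where
      vertex-to-edge : flowFactor true false ≡ flowFactor false true
      vertex-to-edge = begin
        wJ H T k * (1ℚ * Wedge d r)               ≡⟨ cong (wJ H T k *_) (ℚP.*-identityˡ _) ⟩
        wJ H T k * Wedge d r                      ≡⟨ weight-ratio H k ⟩
        wI H T k * Wvertex d r                    ≡⟨ sym (ℚP.*-identityˡ _) ⟩
        1ℚ * (wI H T k * Wvertex d r)             ≡⟨ cong (_* (wI H T k * Wvertex d r)) (sym (÷'-inverse (ℕ→ℚ T) T-nonzero)) ⟩
        (ℕ→ℚ T * (1ℚ ÷' ℕ→ℚ T)) * (wI H T k * Wvertex d r)
          ≡⟨ solve 4 (λ t t⁻¹ a b → (t :* t⁻¹) :* (a :* b) := (t :* a) :* (t⁻¹ :* b)) refl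
               (ℕ→ℚ T) (1ℚ ÷' ℕ→ℚ T) (wI H T k) (Wvertex d r) ⟩
        (ℕ→ℚ T * wI H T k) * ((1ℚ ÷' ℕ→ℚ T) * Wvertex d r) ∎
        where open ≡-Reasoning
    flowFactor-sym false true = sym (flowFactor-sym true false)

    flow-factor : ∀ {x y} → y ∈ Ω → π x * P H T k x y ≡ (κ * ρ) * (flowFactor (zeroOffset x) (zeroOffset y) * facetKernel x y)
    flow-factor {x} {y} y∈ = begin
      π x * P H T k x y
        ≡⟨ cong₂ _*_ (π-factor x) (trans (P-factor x y) (cong (targetFactor (zeroOffset y) *_)
             (trans (downUp-factor x y) (cong (λ t → ρ * (t * facetKernel x y)) (Ω-weight y∈))))) ⟩
      (κ * massOf (zeroOffset x)) * (targetFactor (zeroOffset y) * (ρ * (stateWeight (zeroOffset y) * facetKernel x y)))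
        ≡⟨ solve 6 (λ K p t c w S → (K :* p) :* (t :* (c :* (w :* S))) := (K :* c) :* ((p :* (t :* w)) :* S)) refl
             κ (massOf (zeroOffset x)) (targetFactor (zeroOffset y)) ρ (stateWeight (zeroOffset y)) (facetKernel x y) ⟩
      (κ * ρ) * (flowFactor (zeroOffset x) (zeroOffset y) * facetKernel x y) ∎
      where open ≡-Reasoning

    detailedBalance : ∀ {x y} → x ∈ Ω → y ∈ Ω → π x * P H T k x y ≡ π y * P H T k y x
    detailedBalance {x} {y} x∈ y∈ = trans (flow-factor y∈) (trans
      (cong₂ (λ a b → (κ * ρ) * (a * b)) (flowFactor-sym (zeroOffset x) (zeroOffset y))
                                         (facetKernel-sym (trans (Ω-size x∈) (sym (Ω-size y∈)))))
      (sym (flow-factor x∈)))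

    stationary : ∀ y → y ∈ Ω → ΣL Ω (λ x → π x * R H T k u c x y) ≡ π y
    stationary = detailedBalance⇒stationary Ω eqCfg (P H T k) π eqCfg-sym Ω-delta detailedBalance

    -- The states of Ω are the (k+1)-sized configurations with
    -- image in {u,c} (2^(k+1) value patterns per support), among them those with
    -- image {u} or {c} (one pattern each) are 0-offset.
    u≢c : u ≢ c
    u≢c refl = false≢true (trans (sym (Graph.irrefl G u)) u~c)

    sized : Cfg → Bool
    sized x = size x ℕ.≡ᵇ suc k

    constantly : V → Cfg → Bool
    constantly a x = all (eqV a) (values x)

    α β : ℚ
    α = ℕ→ℚ T * wI H T k
    β = wJ H T k - α

    π-summand : ∀ x → ind (isFace k x) (ind (onUC x) (π x))
                      ≡ κ * (α * ind (sized x ∧ onUC x) 1ℚ + β * (ind (sized x ∧ constantly u x) 1ℚ + ind (sized x ∧ constantly c x) 1ℚ))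
    π-summand x = trans (cong (λ t → ind (isFace k x) (ind (onUC x) t)) (π-factor x))
      (summand-by-type κ α (wJ H T k) (sized x) (imageOK x) (onUC x) (constantly u x) (constantly c x) (zeroOffset x)
        not-both u-onUC c-onUC admissible offset)
      where
      vs = values x
      u-onUC : constantly u x ≡ true → onUC x ≡ true
      u-onUC e = all-intro (inPair u c) vs (λ {z} z∈ → inPair-complete {u} {c} {z} (inj₁ (sym (eqF-true (all-∈ (eqV u) vs e z∈)))))
      c-onUC : constantly c x ≡ true → onUC x ≡ true
      c-onUC e = all-intro (inPair u c) vs (λ {z} z∈ → inPair-complete {u} {c} {z} (inj₂ (sym (eqF-true (all-∈ (eqV c) vs e z∈)))))
      not-both : sized x ≡ true → constantly u x ≡ true → constantly c x ≡ true → ⊥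
      not-both sz eU eC = let (a , a∈) = values-nonempty vs k (≡ᵇ-true sz)
        in u≢c (trans (eqF-true (all-∈ (eqV u) vs eU a∈)) (sym (eqF-true (all-∈ (eqV c) vs eC a∈))))
      admissible : sized x ≡ true → onUC x ≡ true → imageOK x ≡ true
      admissible _ on = trans (cong (allEqual vs ∨_) (onEdge-intro vs u~c on)) (BoolP.∨-zeroʳ _)
      offset : sized x ≡ true → onUC x ≡ true → zeroOffset x ≡ (constantly u x ∨ constantly c x)
      offset sz on = allEqual-onPair u≢c vs on (values-nonempty vs k (≡ᵇ-true sz))

    binomℚ : ℚ
    binomℚ = ℕ→ℚ (binom s (suc k))

    count-onUC : ΣCfg s (λ x → ind (sized x ∧ onUC x) 1ℚ) ≡ binomℚ * (pow2 k + pow2 k)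
    count-onUC = trans (ΣCfg-count (inPair u c) s (suc k)) (cong (binomℚ *_)
      (trans (cong (λ q → powℚ q (suc k)) two-vertices) (trans (powℚ-two (suc k)) (pow2-suc k))))
      where
      two-vertices : ΣV (λ v → ind (inPair u c v) 1ℚ) ≡ 1ℚ + 1ℚ
      two-vertices = trans (ΣV-cong (λ v → ind-pair u≢c v 1ℚ))
        (trans (ΣV-+ _ _) (cong₂ _+_ (sum-delta' (n G) u (λ _ → 1ℚ)) (sum-delta' (n G) c (λ _ → 1ℚ))))

    count-constantly : ∀ a → ΣCfg s (λ x → ind (sized x ∧ constantly a x) 1ℚ) ≡ binomℚ * 1ℚ
    count-constantly a = trans (ΣCfg-count (eqV a) s (suc k)) (cong (binomℚ *_)
      (trans (cong (λ q → powℚ q (suc k)) (sum-delta' (n G) a (λ _ → 1ℚ))) (powℚ-one (suc k))))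

    D-form : D ≡ (pow2 k - 1ℚ) * ℕ→ℚ T * wI H T k + wJ H T k
    D-form = cong (λ t → t * ℕ→ℚ T * wI H T k + wJ H T k) (ℕ→ℚ-∸ (2 ℕ.^ k) 1 (ℕP.m^n>0 2 k))

    normalised : ΣL Ω π ≡ 1ℚ
    normalised = begin
      ΣL Ω π
        ≡⟨ ΣΩ π ⟩
      ΣCfg s (λ x → ind (isFace k x) (ind (onUC x) (π x)))
        ≡⟨ ΣL-cong allCfg π-summand ⟩
      ΣCfg s (λ x → κ * (α * ind (sized x ∧ onUC x) 1ℚ + β * (ind (sized x ∧ constantly u x) 1ℚ + ind (sized x ∧ constantly c x) 1ℚ)))
        ≡⟨ trans (ΣL-* allCfg κ _) (cong (κ *_) (trans (ΣL-+ allCfg _ _) (cong₂ _+_ (ΣL-* allCfg α _)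
             (trans (ΣL-* allCfg β _) (cong (β *_) (ΣL-+ allCfg _ _)))))) ⟩
      κ * (α * ΣCfg s (λ x → ind (sized x ∧ onUC x) 1ℚ)
           + β * (ΣCfg s (λ x → ind (sized x ∧ constantly u x) 1ℚ) + ΣCfg s (λ x → ind (sized x ∧ constantly c x) 1ℚ)))
        ≡⟨ cong (κ *_) (cong₂ (λ a b → α * a + β * b) count-onUC (cong₂ _+_ (count-constantly u) (count-constantly c))) ⟩
      κ * (α * (binomℚ * (pow2 k + pow2 k)) + β * (binomℚ * 1ℚ + binomℚ * 1ℚ))
        ≡⟨ cong (κ *_) (solve 5 (λ t wi wj b p → (t :* wi) :* (b :* (p :+ p)) :+ (wj :- t :* wi) :* (b :* con 1ℚ :+ b :* con 1ℚ)
                                   := (b :* (con 1ℚ :+ con 1ℚ)) :* ((p :- con 1ℚ) :* t :* wi :+ wj)) refl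
              (ℕ→ℚ T) (wI H T k) (wJ H T k) binomℚ (pow2 k)) ⟩
      κ * ((binomℚ * (1ℚ + 1ℚ)) * ((pow2 k - 1ℚ) * ℕ→ℚ T * wI H T k + wJ H T k))
        ≡⟨ cong (κ *_) (cong₂ _*_ (cong₂ _*_ (cong ℕ→ℚ (binom≡C s (suc k))) ℕ→ℚ-two) (sym D-form)) ⟩
      κ * ((ℕ→ℚ (s C suc k) * ℕ→ℚ 2) * D)
        ≡⟨ reciprocal-product (ℕ→ℚ (s C suc k)) (ℕ→ℚ 2) D binom-nonzero (ℕ→ℚ-nonzero {2} (s≤s z≤n)) D-nonzero ⟩
      1ℚ ∎
      where open ≡-Reasoning

-- The theorem.
mainTheorem6 : (H s T : ℕ) (G : Graph) → 1 ≤ H → H ℕ.+ 1 ≤ s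
    → TriangleFree G → Regular G T
    → (k : ℕ) → 1 ≤ k → k < H
    → (u c : Fin (n G)) → adj G u c ≡ true
    → IsStationaryDistribution (Complex.Ωe G s k u c)
    (Complex.R G s H T k u c) (Complex.πclaim G s H T k)
mainTheorem6 H s T G _ H+1≤s _ regular k _ k<H u c u~c = normalised , stationary
  where open FaceCombinatorics.OnEdge G s H T k regular k<H H+1≤s u c u~c
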